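{- $WELL\leq_m ATile$.
   Context: $\varphi_e$ denotes the $e$-th partial computable function; $\leq_m$ is many-one reducibility. A tree is a subset of $\omega^{<\omega}$ closed under initial segments; $WELL=\{e:\varphi_e$ is the characteristic function of a tree $T\subseteq\omega^{<\omega}$ with no infinite path$\}$. A Wang prototile is a 4-tuple $\langle l,u,r,b\rangle$ of colours (natural numbers) for left, upper, right, bottom quarters; prototile sets are identified with sets of codes. A total $S$-tiling is a map $T:\mathbb{Z}^2\to S$ with right colour of $T(x,y)$ = left colour of $T(x+1,y)$ and upper colour of $T(x,y)$ = bottom colour of $T(x,y+1)$ (no rotations); it is periodic if $T(p+\mathbf v)=T(p)$ for all $p$ for some nonzero $\mathbf v\in\mathbb{Z}^2$, aperiodic otherwise. $ATile=\{e:\varphi_e$ is the characteristic function of a set $S$ of Wang prototiles which has at least one total $S$-tiling and all of whose total tilings are aperiodic$\}$. -}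

module Defs where

open import Data.Nat using (ℕ; zero; suc; _+_; _<_)
open import Data.Integer as ℤ using (ℤ)
open import Data.Product using (Σ; _×_; _,_; proj₁; proj₂; ∃)
open import Data.Sum using (_⊎_)
open import Data.List using (List; []; _∷_; _++_; applyUpTo)
open import Relation.Binary.PropositionalEquality using (_≡_)
open import Relation.Nullary using (¬_)
open import Function.Bundles using (_⇔_)

-- Cantor pairing: unpair enumerates ℕ×ℕ diagonal by diagonal
-- (0,0),(1,0),(0,1),(2,0),(1,1),(0,2),... ; pair is its inverse.

unpair : ℕ → ℕ × ℕ
unpair zero = (0 , 0)
unpair (suc n) with unpair n
... | (zero , b) = (suc b , 0)
... | (suc a , b) = (a , suc b)

tri : ℕ → ℕ
tri zero = 0
tri (suc s) = tri s + suc s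

pair : ℕ → ℕ → ℕ
pair a b = tri (a + b) + b

-- A model of partial computable functions: unary partial recursive
-- functions with pairing (Turing complete).

data Code : Set where
  zeroC sucC idC fstC sndC : Code
  compC  : Code → Code → Code
  pairC  : Code → Code → Code
  precC  : Code → Code → Code     -- h⟨x,0⟩ = f x ; h⟨x,n+1⟩ = g⟨x,⟨n,h⟨x,n⟩⟩⟩
  muC    : Code → Code            -- x ↦ least n with f⟨x,n⟩ = 0

data Eval : Code → ℕ → ℕ → Set where
  ev-zero : ∀ x → Eval zeroC x 0
  ev-suc  : ∀ x → Eval sucC x (suc x)
  ev-id   : ∀ x → Eval idC x x
  ev-fst  : ∀ x → Eval fstC x (proj₁ (unpair x))
  ev-snd  : ∀ x → Eval sndC x (proj₂ (unpair x))
  ev-comp : ∀ {f g x y z} → Eval g x y → Eval f y z → Eval (compC f g) x z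
  ev-pair : ∀ {f g x y z} → Eval f x y → Eval g x z → Eval (pairC f g) x (pair y z)
  ev-prec-z : ∀ {f g x y} → Eval f x y → Eval (precC f g) (pair x 0) y
  ev-prec-s : ∀ {f g x n y w} → Eval (precC f g) (pair x n) y →
              Eval g (pair x (pair n y)) w → Eval (precC f g) (pair x (suc n)) w
  ev-mu   : ∀ {f x n} → Eval f (pair x n) 0 →
            (∀ m → m < n → Σ ℕ (λ k → Eval f (pair x m) (suc k))) →
            Eval (muC f) x n

-- Gödel numbering of codes (with fuel; fuel suc e suffices for e, since
-- components of a compound code have strictly smaller numbers).
decodeTag : ℕ → ℕ → ℕ → Code
decodeCode : ℕ → ℕ → Code

decodeTag k 0 r = zeroC
decodeTag k 1 r = idC
decodeTag k 2 r = sucC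
decodeTag k 3 r = fstC
decodeTag k 4 r = sndC
decodeTag k 5 r = compC (decodeCode k (proj₁ (unpair r))) (decodeCode k (proj₂ (unpair r)))
decodeTag k 6 r = pairC (decodeCode k (proj₁ (unpair r))) (decodeCode k (proj₂ (unpair r)))
decodeTag k 7 r = precC (decodeCode k (proj₁ (unpair r))) (decodeCode k (proj₂ (unpair r)))
decodeTag k 8 r = muC (decodeCode k r)
decodeTag k (suc (suc (suc (suc (suc (suc (suc (suc (suc _))))))))) r = zeroC

decodeCode zero n = zeroC
decodeCode (suc k) n = decodeTag k (proj₁ (unpair n)) (proj₂ (unpair n))

Φ : ℕ → ℕ → ℕ → Set
Φ e x y = Eval (decodeCode (suc e) e) x y

CharFn : ℕ → Set
CharFn e = ∀ x → Σ ℕ (λ y → Φ e x y × (y ≡ 0 ⊎ y ≡ 1))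

_≤m_ : (ℕ → Set) → (ℕ → Set) → Set
A ≤m B = Σ ℕ (λ r → (∀ x → Σ ℕ (λ y → Φ r x y)) ×
                    (∀ x y → Φ r x y → (A x ⇔ B y)))

codeSeq : List ℕ → ℕ
codeSeq [] = 0
codeSeq (a ∷ σ) = suc (pair a (codeSeq σ))

InTree : ℕ → List ℕ → Set
InTree e σ = Φ e (codeSeq σ) 1

IsTree : ℕ → Set
IsTree e = ∀ τ ρ → InTree e (τ ++ ρ) → InTree e τ

WELL : ℕ → Set
WELL e = CharFn e × IsTree e ×
         ¬ (Σ (ℕ → ℕ) (λ p → ∀ k → InTree e (applyUpTo p k)))

record Tile : Set where
  constructor ⟨_,_,_,_⟩
  field
    left up right bottom : ℕ
open Tile public

encodeTile : Tile → ℕ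
encodeTile t = pair (left t) (pair (up t) (pair (right t) (bottom t)))

Tiling : ℕ → (ℤ → ℤ → Tile) → Set
Tiling e T = (∀ x y → Φ e (encodeTile (T x y)) 1) ×
             (∀ x y → right (T x y) ≡ left (T (x ℤ.+ ℤ.1ℤ) y)) ×
             (∀ x y → up (T x y) ≡ bottom (T x (y ℤ.+ ℤ.1ℤ)))

Periodic : (ℤ → ℤ → Tile) → Set
Periodic T = Σ ℤ (λ a → Σ ℤ (λ b → ¬ (a ≡ ℤ.0ℤ × b ≡ ℤ.0ℤ) ×
               (∀ x y → T (x ℤ.+ a) (y ℤ.+ b) ≡ T x y)))

ATile : ℕ → Set
ATile e = CharFn e ×
          Σ (ℤ → ℤ → Tile) (Tiling e) ×
          (∀ T → Tiling e T → ¬ Periodic T)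

-- Given e, the reduction computes a code for the set S_e of prototiles accepted
-- by a checker that consults φ_e. The colours of a tile share a tag choosing one
-- of three families, so every tiling uses a single family. Counter tiles carry
-- integer coordinates increasing by one to the right and upwards: they always
-- tile the plane, but only aperiodically. Path tiles stack into columns whose
-- vertical colours hold a counter running down to 0 and then ever longer
-- sequences accepted by φ_e; their horizontal colours are free, so a column
-- tiles the plane periodically, and columns exist exactly when φ_e has an
-- infinite path. Bad tiles record a sequence accepted by φ_e whose prefix is
-- rejected, and tile the plane constantly. Hence all tilings by S_e are
-- aperiodic iff φ_e is a tree without infinite paths. A penalty in the checker
-- ensures that membership in S_e is {0,1}-valued only if φ_e is.

module Submission where

open import Defs
open import Data.Nat
open import Data.Nat.Properties
open import Data.Integer as ℤ using (ℤ; +_; -[1+_]; 0ℤ; 1ℤ)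
import Data.Integer.Properties as ℤ
open import Data.Integer.Tactic.RingSolver using (solve-∀)
open import Algebra.Properties.AbelianGroup ℤ.+-0-abelianGroup using (identityʳ-unique; ∙-cancelʳ)
open import Data.Product using (Σ; _×_; _,_; proj₁; proj₂)
open import Data.Product.Properties using (,-injectiveˡ; ,-injectiveʳ)
open import Data.Sum using (_⊎_; inj₁; inj₂; [_,_]′)
open import Data.Empty using (⊥-elim)
open import Data.List using (List; []; _∷_; _++_; _∷ʳ_; [_]; _ʳ++_; reverse; length; applyUpTo)
open import Data.List.Properties
  using (++-identityʳ; ++-assoc; applyUpTo-∷ʳ; reverse-++; reverse-involutive; unfold-reverse)
open import Function using (_∘_; id)
open import Function.Bundles using (_⇔_; mk⇔; Equivalence)
open import Relation.Binary.Definitions using (tri<; tri≈; tri>)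
open import Relation.Nullary using (¬_)
open import Relation.Binary.PropositionalEquality hiding ([_])

-- Cantor pairing

π₁ π₂ : ℕ → ℕ
π₁ n = proj₁ (unpair n)
π₂ n = proj₂ (unpair n)

pair-suc : ∀ a b → pair a (suc b) ≡ suc (pair (suc a) b)
pair-suc a b rewrite +-suc a b = +-suc (tri (suc (a + b))) b

pair-suc-zero : ∀ a → pair (suc a) 0 ≡ suc (pair 0 a)
pair-suc-zero a rewrite +-identityʳ a | +-identityʳ (tri a + suc a) = +-suc (tri a) a

private
  -- The extra argument s = a + b makes the recursion structural: unpair walks
  -- each diagonal by decreasing b, then jumps to the start of the next one.
  unpair-pair-on : ∀ s a b → a + b ≡ s → unpair (pair a b) ≡ (a , b)
  unpair-pair-on s zero zero eq = refl
  unpair-pair-on (suc s) (suc a) zero eq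
    rewrite pair-suc-zero a
          | unpair-pair-on s zero a (trans (sym (+-identityʳ a)) (suc-injective eq)) = refl
  unpair-pair-on s a (suc b) eq
    rewrite pair-suc a b
          | unpair-pair-on s (suc a) b (trans (sym (+-suc a b)) eq) = refl

unpair-pair : ∀ a b → unpair (pair a b) ≡ (a , b)
unpair-pair a b = unpair-pair-on (a + b) a b refl

π₁-pair : ∀ a b → π₁ (pair a b) ≡ a
π₁-pair a b = cong proj₁ (unpair-pair a b)

π₂-pair : ∀ a b → π₂ (pair a b) ≡ b
π₂-pair a b = cong proj₂ (unpair-pair a b)

pair-injective : ∀ a b c d → pair a b ≡ pair c d → a ≡ c × b ≡ d
pair-injective a b c d eq =
  ,-injectiveˡ equal-unpairs , ,-injectiveʳ equal-unpairs
  where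
  equal-unpairs : (a , b) ≡ (c , d)
  equal-unpairs = trans (sym (unpair-pair a b)) (trans (cong unpair eq) (unpair-pair c d))

pair-unpair : ∀ n → pair (π₁ n) (π₂ n) ≡ n
pair-unpair zero = refl
pair-unpair (suc n) with unpair n | pair-unpair n
... | zero  , b | eq = trans (pair-suc-zero b) (cong suc eq)
... | suc a , b | eq = trans (pair-suc a b) (cong suc eq)

tri-≥ : ∀ s → s ≤ tri s
tri-≥ zero = z≤n
tri-≥ (suc s) = m≤n+m (suc s) (tri s)

pair-≥ˡ : ∀ a b → a ≤ pair a b
pair-≥ˡ a b = ≤-trans (≤-trans (m≤m+n a b) (tri-≥ (a + b))) (m≤m+n (tri (a + b)) b)

pair-≥ʳ : ∀ a b → b ≤ pair a b
pair-≥ʳ a b = m≤n+m b (tri (a + b))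

pair->ʳ : ∀ a b → 0 < a → b < pair a b
pair->ʳ (suc a) b _ =
  ≤-trans (s≤s (m≤n+m b a)) (≤-trans (tri-≥ (suc a + b)) (m≤m+n (tri (suc a + b)) b))

π₁-≤ : ∀ n → π₁ n ≤ n
π₁-≤ n = subst (π₁ n ≤_) (pair-unpair n) (pair-≥ˡ (π₁ n) (π₂ n))

π₂-≤ : ∀ n → π₂ n ≤ n
π₂-≤ n = subst (π₂ n ≤_) (pair-unpair n) (pair-≥ʳ (π₁ n) (π₂ n))

π₂-< : ∀ n → 0 < π₁ n → π₂ n < n
π₂-< n 0<π₁ = subst (π₂ n <_) (pair-unpair n) (pair->ʳ (π₁ n) (π₂ n) 0<π₁)

Eval-deterministic : ∀ {c x x′ y y′} → Eval c x y → Eval c x′ y′ → x ≡ x′ → y ≡ y′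
Eval-deterministic (ev-zero _) (ev-zero _) eq = refl
Eval-deterministic (ev-suc _) (ev-suc _) eq = cong suc eq
Eval-deterministic (ev-id _) (ev-id _) eq = eq
Eval-deterministic (ev-fst _) (ev-fst _) eq = cong π₁ eq
Eval-deterministic (ev-snd _) (ev-snd _) eq = cong π₂ eq
Eval-deterministic (ev-comp g f) (ev-comp g′ f′) eq =
  Eval-deterministic f f′ (Eval-deterministic g g′ eq)
Eval-deterministic (ev-pair f g) (ev-pair f′ g′) eq =
  cong₂ pair (Eval-deterministic f f′ eq) (Eval-deterministic g g′ eq)
Eval-deterministic (ev-prec-z {x = x} f) (ev-prec-z {x = x′} f′) eq =
  Eval-deterministic f f′ (proj₁ (pair-injective x 0 x′ 0 eq))
Eval-deterministic (ev-prec-z {x = x} _) (ev-prec-s {x = x′} {n′} _ _) eq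
  with () ← proj₂ (pair-injective x 0 x′ (suc n′) eq)
Eval-deterministic (ev-prec-s {x = x} {n} _ _) (ev-prec-z {x = x′} _) eq
  with () ← proj₂ (pair-injective x (suc n) x′ 0 eq)
Eval-deterministic (ev-prec-s {x = x} {n} h g) (ev-prec-s {x = x′} {n′} h′ g′) eq
  with refl , refl ← pair-injective x (suc n) x′ (suc n′) eq =
  Eval-deterministic g g′ (cong (λ y → pair x (pair n y)) (Eval-deterministic h h′ refl))
Eval-deterministic (ev-mu {n = n} f0 fs) (ev-mu {n = n′} f0′ fs′) refl with <-cmp n n′
... | tri≈ _ n≡n′ _ = n≡n′
... | tri< n<n′ _ _ with () ← Eval-deterministic f0 (proj₂ (fs′ n n<n′)) refl
... | tri> _ _ n>n′ with () ← Eval-deterministic f0′ (proj₂ (fs n′ n>n′)) refl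

record Program : Set where
  constructor program
  field
    code : Code
    run  : ℕ → ℕ
    evaluates : ∀ x → Eval code x (run x)
open Program public

Eval-≡ : ∀ {c x y z} → Eval c x y → y ≡ z → Eval c x z
Eval-≡ ev refl = ev

idᴾ zeroᴾ sucᴾ fstᴾ sndᴾ : Program
idᴾ = program idC (λ x → x) ev-id
zeroᴾ = program zeroC (λ _ → 0) ev-zero
sucᴾ = program sucC suc ev-suc
fstᴾ = program fstC π₁ ev-fst
sndᴾ = program sndC π₂ ev-snd

infixr 9 _∘ᴾ_
_∘ᴾ_ : Program → Program → Program
f ∘ᴾ g = program (compC (code f) (code g)) (λ x → run f (run g x))
  (λ x → ev-comp (evaluates g x) (evaluates f (run g x)))

⟨_,_⟩ᴾ : Program → Program → Program
⟨ f , g ⟩ᴾ = program (pairC (code f) (code g)) (λ x → pair (run f x) (run g x))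
  (λ x → ev-pair (evaluates f x) (evaluates g x))

constᴾ : ℕ → Program
constᴾ zero = zeroᴾ
constᴾ (suc n) = sucᴾ ∘ᴾ constᴾ n

primRec : (ℕ → ℕ) → (ℕ → ℕ) → ℕ → ℕ → ℕ
primRec f g x zero = f x
primRec f g x (suc n) = g (pair x (pair n (primRec f g x n)))

primRec-evaluates : ∀ (f g : Program) x n →
  Eval (precC (code f) (code g)) (pair x n) (primRec (run f) (run g) x n)
primRec-evaluates f g x zero = ev-prec-z {x = x} (evaluates f x)
primRec-evaluates f g x (suc n) =
  ev-prec-s {x = x} {n} (primRec-evaluates f g x n) (evaluates g _)

record Computes₂ (op : ℕ → ℕ → ℕ) : Set where
  constructor computes₂
  field
    code₂ : Code
    evaluates₂ : ∀ a b → Eval code₂ (pair a b) (op a b)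

apply₂ᴾ : ∀ {op} → Computes₂ op → Program → Program → Program
apply₂ᴾ {op} M f g =
  program (compC (Computes₂.code₂ M) (pairC (code f) (code g)))
          (λ x → op (run f x) (run g x))
          (λ x → ev-comp (ev-pair (evaluates f x) (evaluates g x))
                         (Computes₂.evaluates₂ M _ _))

recursion₂ : ∀ {op} (f g : Program) →
  (∀ a → run f a ≡ op a 0) →
  (∀ a n → run g (pair a (pair n (op a n))) ≡ op a (suc n)) →
  Computes₂ op
recursion₂ {op} f g base step = computes₂ (precC (code f) (code g))
  (λ a b → Eval-≡ (primRec-evaluates f g a b) (agrees a b))
  where
  agrees : ∀ a b → primRec (run f) (run g) a b ≡ op a b
  agrees a zero = base a
  agrees a (suc b) rewrite agrees a b = step a b

previous : ∀ a n y → π₂ (π₂ (pair a (pair n y))) ≡ y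
previous a n y rewrite π₂-pair a (pair n y) = π₂-pair n y

+-computes : Computes₂ _+_
+-computes = recursion₂ idᴾ (sucᴾ ∘ᴾ sndᴾ ∘ᴾ sndᴾ)
  (λ a → sym (+-identityʳ a))
  (λ a n → trans (cong suc (previous a n (a + n))) (sym (+-suc a n)))

-- Primitive recursion always carries a parameter, here an ignored one.
pred-computes : Computes₂ (λ _ n → pred n)
pred-computes = recursion₂ zeroᴾ (fstᴾ ∘ᴾ sndᴾ)
  (λ _ → refl)
  (λ a n → trans (cong π₁ (π₂-pair a (pair n (pred n)))) (π₁-pair n (pred n)))

predᴾ : Program → Program
predᴾ f = apply₂ᴾ pred-computes zeroᴾ f

∸-computes : Computes₂ _∸_
∸-computes = recursion₂ idᴾ (predᴾ (sndᴾ ∘ᴾ sndᴾ))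
  (λ _ → refl)
  (λ a n → trans (cong pred (previous a n (a ∸ n))) (pred[m∸n]≡m∸[1+n] a n))

ifz : ℕ → ℕ → ℕ → ℕ
ifz zero    a b = a
ifz (suc _) a b = b

ifz-computes : Computes₂ (λ ab n → ifz n (π₁ ab) (π₂ ab))
ifz-computes = recursion₂ fstᴾ (sndᴾ ∘ᴾ fstᴾ)
  (λ _ → refl)
  (λ ab n → cong π₂ (π₁-pair ab (pair n (ifz n (π₁ ab) (π₂ ab)))))

ifzᴾ : Program → Program → Program → Program
ifzᴾ c a b = program (code body) (λ x → ifz (run c x) (run a x) (run b x))
  (λ x → Eval-≡ (evaluates body x)
                (cong₂ (ifz (run c x)) (π₁-pair (run a x) (run b x)) (π₂-pair (run a x) (run b x))))
  where
  body : Program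
  body = apply₂ᴾ ifz-computes ⟨ a , b ⟩ᴾ c

infixl 6 _+ᴾ_ _∸ᴾ_
_+ᴾ_ _∸ᴾ_ : Program → Program → Program
f +ᴾ g = apply₂ᴾ +-computes f g
f ∸ᴾ g = apply₂ᴾ ∸-computes f g

dist : ℕ → ℕ → ℕ
dist a b = (a ∸ b) + (b ∸ a)

distᴾ : Program → Program → Program
distᴾ f g = (f ∸ᴾ g) +ᴾ (g ∸ᴾ f)

dist≡0⇒≡ : ∀ a b → dist a b ≡ 0 → a ≡ b
dist≡0⇒≡ a b eq = ≤-antisym (m∸n≡0⇒m≤n (m+n≡0⇒m≡0 (a ∸ b) eq))
                            (m∸n≡0⇒m≤n (m+n≡0⇒n≡0 (a ∸ b) eq))

≡⇒dist≡0 : ∀ {a b} → a ≡ b → dist a b ≡ 0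
≡⇒dist≡0 {a} refl rewrite n∸n≡0 a = refl

-- Gödel numbering

decode : ℕ → Code
decode n = decodeCode (suc n) n

decodeTag-stable : ∀ k k′ t r →
  (0 < t → ∀ m → m ≤ r → decodeCode k m ≡ decodeCode k′ m) →
  decodeTag k t r ≡ decodeTag k′ t r
decodeTag-stable k k′ 0 r agree = refl
decodeTag-stable k k′ 1 r agree = refl
decodeTag-stable k k′ 2 r agree = refl
decodeTag-stable k k′ 3 r agree = refl
decodeTag-stable k k′ 4 r agree = refl
decodeTag-stable k k′ 5 r agree = cong₂ compC (agree (s≤s z≤n) _ (π₁-≤ r)) (agree (s≤s z≤n) _ (π₂-≤ r))
decodeTag-stable k k′ 6 r agree = cong₂ pairC (agree (s≤s z≤n) _ (π₁-≤ r)) (agree (s≤s z≤n) _ (π₂-≤ r))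
decodeTag-stable k k′ 7 r agree = cong₂ precC (agree (s≤s z≤n) _ (π₁-≤ r)) (agree (s≤s z≤n) _ (π₂-≤ r))
decodeTag-stable k k′ 8 r agree = cong muC (agree (s≤s z≤n) _ ≤-refl)
decodeTag-stable k k′ (suc (suc (suc (suc (suc (suc (suc (suc (suc _))))))))) r agree = refl

decodeCode-stable : ∀ k k′ n → n < k → n < k′ → decodeCode k n ≡ decodeCode k′ n
decodeCode-stable (suc k) (suc k′) n n<k n<k′ =
  decodeTag-stable k k′ (π₁ n) (π₂ n) λ 0<t m m≤r →
    decodeCode-stable k k′ m (below 0<t m≤r n<k) (below 0<t m≤r n<k′)
  where
  below : ∀ {j m} → 0 < π₁ n → m ≤ π₂ n → n < suc j → m < j
  below 0<t m≤r n<j = ≤-trans (s≤s m≤r) (≤-trans (π₂-< n 0<t) (≤-pred n<j))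

decodeCode-enough-fuel : ∀ k n → n < k → decodeCode k n ≡ decode n
decodeCode-enough-fuel k n n<k = decodeCode-stable k (suc n) n n<k ≤-refl

decode-pair : ∀ t r → decode (pair t r) ≡ decodeTag (pair t r) t r
decode-pair t r rewrite unpair-pair t r = refl

private
  component₁ : ∀ t a b → 0 < t → decodeCode (pair t (pair a b)) (π₁ (pair a b)) ≡ decode a
  component₁ t a b 0<t rewrite π₁-pair a b =
    decodeCode-enough-fuel _ a (≤-<-trans (pair-≥ˡ a b) (pair->ʳ t (pair a b) 0<t))

  component₂ : ∀ t a b → 0 < t → decodeCode (pair t (pair a b)) (π₂ (pair a b)) ≡ decode b
  component₂ t a b 0<t rewrite π₂-pair a b =
    decodeCode-enough-fuel _ b (≤-<-trans (pair-≥ʳ a b) (pair->ʳ t (pair a b) 0<t))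

decode-compC : ∀ a b → decode (pair 5 (pair a b)) ≡ compC (decode a) (decode b)
decode-compC a b = trans (decode-pair 5 (pair a b))
  (cong₂ compC (component₁ 5 a b (s≤s z≤n)) (component₂ 5 a b (s≤s z≤n)))

decode-pairC : ∀ a b → decode (pair 6 (pair a b)) ≡ pairC (decode a) (decode b)
decode-pairC a b = trans (decode-pair 6 (pair a b))
  (cong₂ pairC (component₁ 6 a b (s≤s z≤n)) (component₂ 6 a b (s≤s z≤n)))

decode-precC : ∀ a b → decode (pair 7 (pair a b)) ≡ precC (decode a) (decode b)
decode-precC a b = trans (decode-pair 7 (pair a b))
  (cong₂ precC (component₁ 7 a b (s≤s z≤n)) (component₂ 7 a b (s≤s z≤n)))

decode-muC : ∀ a → decode (pair 8 a) ≡ muC (decode a)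
decode-muC a = trans (decode-pair 8 a)
  (cong muC (decodeCode-enough-fuel _ a (pair->ʳ 8 a (s≤s z≤n))))

quoting : Code → Program
quoting zeroC = ⟨ constᴾ 0 , constᴾ 0 ⟩ᴾ
quoting idC = ⟨ constᴾ 1 , constᴾ 0 ⟩ᴾ
quoting sucC = ⟨ constᴾ 2 , constᴾ 0 ⟩ᴾ
quoting fstC = ⟨ constᴾ 3 , constᴾ 0 ⟩ᴾ
quoting sndC = ⟨ constᴾ 4 , constᴾ 0 ⟩ᴾ
quoting (compC f g) = ⟨ constᴾ 5 , ⟨ quoting f , quoting g ⟩ᴾ ⟩ᴾ
quoting (pairC f g) = ⟨ constᴾ 6 , ⟨ quoting f , quoting g ⟩ᴾ ⟩ᴾ
quoting (precC f g) = ⟨ constᴾ 7 , ⟨ quoting f , quoting g ⟩ᴾ ⟩ᴾ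
quoting (muC f) = ⟨ constᴾ 8 , quoting f ⟩ᴾ

-- Opaque so that the numerals of concrete codes are never normalised.
opaque
  encode : Code → ℕ
  encode zeroC = pair 0 0
  encode idC = pair 1 0
  encode sucC = pair 2 0
  encode fstC = pair 3 0
  encode sndC = pair 4 0
  encode (compC f g) = pair 5 (pair (encode f) (encode g))
  encode (pairC f g) = pair 6 (pair (encode f) (encode g))
  encode (precC f g) = pair 7 (pair (encode f) (encode g))
  encode (muC f) = pair 8 (encode f)

  decode-encode : ∀ c → decode (encode c) ≡ c
  decode-encode zeroC = decode-pair 0 0
  decode-encode idC = decode-pair 1 0
  decode-encode sucC = decode-pair 2 0
  decode-encode fstC = decode-pair 3 0
  decode-encode sndC = decode-pair 4 0
  decode-encode (compC f g) =
    trans (decode-compC (encode f) (encode g)) (cong₂ compC (decode-encode f) (decode-encode g))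
  decode-encode (pairC f g) =
    trans (decode-pairC (encode f) (encode g)) (cong₂ pairC (decode-encode f) (decode-encode g))
  decode-encode (precC f g) =
    trans (decode-precC (encode f) (encode g)) (cong₂ precC (decode-encode f) (decode-encode g))
  decode-encode (muC f) = trans (decode-muC (encode f)) (cong muC (decode-encode f))

  run-quoting : ∀ c x → run (quoting c) x ≡ encode c
  run-quoting zeroC x = refl
  run-quoting idC x = refl
  run-quoting sucC x = refl
  run-quoting fstC x = refl
  run-quoting sndC x = refl
  run-quoting (compC f g) x = cong (pair 5) (cong₂ pair (run-quoting f x) (run-quoting g x))
  run-quoting (pairC f g) x = cong (pair 6) (cong₂ pair (run-quoting f x) (run-quoting g x))
  run-quoting (precC f g) x = cong (pair 7) (cong₂ pair (run-quoting f x) (run-quoting g x))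
  run-quoting (muC f) x = cong (pair 8) (run-quoting f x)

quoteᴾ : Code → Program
quoteᴾ c = program (code (quoting c)) (λ _ → encode c)
  (λ x → Eval-≡ (evaluates (quoting c) x) (run-quoting c x))

decodeSeqWithin : ℕ → ℕ → List ℕ
decodeSeqWithin zero n = []
decodeSeqWithin (suc k) zero = []
decodeSeqWithin (suc k) (suc m) = π₁ m ∷ decodeSeqWithin k (π₂ m)

codeSeq-decodeSeqWithin : ∀ k n → n ≤ k → codeSeq (decodeSeqWithin k n) ≡ n
codeSeq-decodeSeqWithin zero zero _ = refl
codeSeq-decodeSeqWithin (suc k) zero _ = refl
codeSeq-decodeSeqWithin (suc k) (suc m) m<k
  rewrite codeSeq-decodeSeqWithin k (π₂ m) (≤-trans (π₂-≤ m) (≤-pred m<k)) =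
  cong suc (pair-unpair m)

decodeSeq : ℕ → List ℕ
decodeSeq n = decodeSeqWithin n n

codeSeq-decodeSeq : ∀ n → codeSeq (decodeSeq n) ≡ n
codeSeq-decodeSeq n = codeSeq-decodeSeqWithin n n ≤-refl

length≤codeSeq : ∀ ρ → length ρ ≤ codeSeq ρ
length≤codeSeq [] = z≤n
length≤codeSeq (a ∷ ρ) = s≤s (≤-trans (length≤codeSeq ρ) (pair-≥ʳ a (codeSeq ρ)))

headCode tailCode : ℕ → ℕ
headCode r = π₁ (pred r)
tailCode r = π₂ (pred r)

headᴾ tailᴾ : Program
headᴾ = fstᴾ ∘ᴾ predᴾ idᴾ
tailᴾ = sndᴾ ∘ᴾ predᴾ idᴾ

iterate : (ℕ → ℕ) → ℕ → ℕ → ℕ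
iterate f zero s = s
iterate f (suc k) s = f (iterate f k s)

iterate-computes : (f : Program) → Computes₂ (λ s k → iterate (run f) k s)
iterate-computes f = recursion₂ idᴾ (f ∘ᴾ sndᴾ ∘ᴾ sndᴾ)
  (λ _ → refl)
  (λ s k → cong (run f) (previous s k (iterate (run f) k s)))

iterate-suc : ∀ f k s → iterate f (suc k) s ≡ iterate f k (f s)
iterate-suc f zero s = refl
iterate-suc f (suc k) s = cong f (iterate-suc f k s)

-- One step of reversal acts on a state ⟨rest, accumulated⟩ of two sequence
-- codes by moving the head of rest onto accumulated.
reversalStepᴾ : Program
reversalStepᴾ = ifzᴾ fstᴾ idᴾ ⟨ tailᴾ ∘ᴾ fstᴾ , sucᴾ ∘ᴾ ⟨ headᴾ ∘ᴾ fstᴾ , sndᴾ ⟩ᴾ ⟩ᴾ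

reversalStep : ℕ → ℕ
reversalStep = run reversalStepᴾ

reversalStep-[] : ∀ acc → reversalStep (pair 0 acc) ≡ pair 0 acc
reversalStep-[] acc rewrite π₁-pair 0 acc = refl

reversalStep-∷ : ∀ a r acc → reversalStep (pair (suc (pair a r)) acc) ≡ pair r (suc (pair a acc))
reversalStep-∷ a r acc
  rewrite π₁-pair (suc (pair a r)) acc | π₂-pair (suc (pair a r)) acc
        | π₁-pair a r | π₂-pair a r = refl

iterate-reversalStep-[] : ∀ k acc → iterate reversalStep k (pair 0 acc) ≡ pair 0 acc
iterate-reversalStep-[] zero acc = refl
iterate-reversalStep-[] (suc k) acc
  rewrite iterate-reversalStep-[] k acc = reversalStep-[] acc

iterate-reversalStep : ∀ k ρ acc → length ρ ≤ k →
  iterate reversalStep k (pair (codeSeq ρ) (codeSeq acc)) ≡ pair 0 (codeSeq (ρ ʳ++ acc))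
iterate-reversalStep k [] acc _ = iterate-reversalStep-[] k (codeSeq acc)
iterate-reversalStep (suc k) (a ∷ ρ) acc ρ<k
  rewrite iterate-suc reversalStep k (pair (codeSeq (a ∷ ρ)) (codeSeq acc))
        | reversalStep-∷ a (codeSeq ρ) (codeSeq acc) =
  iterate-reversalStep k ρ (a ∷ acc) (≤-pred ρ<k)

-- Iterating x times suffices, as the code of a sequence bounds its length.
reverseᴾ : Program
reverseᴾ = sndᴾ ∘ᴾ apply₂ᴾ (iterate-computes reversalStepᴾ) ⟨ idᴾ , zeroᴾ ⟩ᴾ idᴾ

reverseCode : ℕ → ℕ
reverseCode = run reverseᴾ

reverseCode-codeSeq : ∀ ρ → reverseCode (codeSeq ρ) ≡ codeSeq (reverse ρ)
reverseCode-codeSeq ρ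
  rewrite iterate-reversalStep (codeSeq ρ) ρ [] (length≤codeSeq ρ) = π₂-pair 0 _

-- The prototiles

-- Colours ⟨t, ⟨a, b⟩⟩: the tag t selects the family of the tile.
tag slot₁ slot₂ : ℕ → ℕ
tag c = π₁ c
slot₁ c = π₁ (π₂ c)
slot₂ c = π₂ (π₂ c)

opaque
  colour : ℕ → ℕ → ℕ → ℕ
  colour t a b = pair t (pair a b)

  tag-colour : ∀ t a b → tag (colour t a b) ≡ t
  tag-colour t a b = π₁-pair t (pair a b)

  slot₁-colour : ∀ t a b → slot₁ (colour t a b) ≡ a
  slot₁-colour t a b = trans (cong π₁ (π₂-pair t (pair a b))) (π₁-pair a b)

  slot₂-colour : ∀ t a b → slot₂ (colour t a b) ≡ b
  slot₂-colour t a b = trans (cong π₂ (π₂-pair t (pair a b))) (π₂-pair a b)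

intOf : ℕ → ℤ
intOf n = + π₁ n ℤ.- + π₂ n

encodeℤ : ℤ → ℕ
encodeℤ (+ m) = pair m 0
encodeℤ -[1+ n ] = pair 0 (suc n)

intOf-encodeℤ : ∀ z → intOf (encodeℤ z) ≡ z
intOf-encodeℤ (+ m) rewrite unpair-pair m 0 = cong +_ (+-identityʳ m)
intOf-encodeℤ -[1+ n ] rewrite unpair-pair 0 (suc n) = refl

record CounterRule (L U R B : ℕ) : Set where
  field
    left≡bottom : L ≡ B
    right₁ : intOf (slot₁ R) ≡ intOf (slot₁ L) ℤ.+ 1ℤ
    right₂ : intOf (slot₂ R) ≡ intOf (slot₂ L)
    up₁ : intOf (slot₁ U) ≡ intOf (slot₁ B)
    up₂ : intOf (slot₂ U) ≡ intOf (slot₂ B) ℤ.+ 1ℤ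

-- Path tiles carry a counter k and a sequence code r on their vertical edges.
-- Sequences are stored reversed, so that the tail π₂ m of r = suc m codes the
-- sequence without its last entry, and χ is asked about reverseCode r. A stem
-- counts down over the empty sequence; a node extends the sequence by one
-- entry, which must keep it in the tree.
data PathRule (χ : ℕ → ℕ) (kU rU kB rB : ℕ) : Set where
  stem : rU ≡ 0 → rB ≡ 0 → kB ≡ suc kU → PathRule χ kU rU kB rB
  node : ∀ m → rU ≡ suc m → kU ≡ 0 → kB ≡ 0 → rB ≡ π₂ m →
         χ (reverseCode (suc m)) ≡ 1 → PathRule χ kU rU kB rB

data BadRule (χ : ℕ → ℕ) (r : ℕ) : Set where
  bad : ∀ m → r ≡ suc m → χ (reverseCode (suc m)) ≡ 1 → χ (reverseCode (π₂ m)) ≡ 0 →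
        BadRule χ r

data FamilyRule (χ : ℕ → ℕ) (L U R B : ℕ) : Set where
  counter : tag L ≡ 0 → CounterRule L U R B → FamilyRule χ L U R B
  path    : tag L ≡ 1 → PathRule χ (slot₁ U) (slot₂ U) (slot₁ B) (slot₂ B) → FamilyRule χ L U R B
  bad     : tag L ≡ 2 → BadRule χ (slot₂ U) → FamilyRule χ L U R B

record Prototile (χ : ℕ → ℕ) (tl : Tile) : Set where
  field
    up-tag     : tag (up tl) ≡ tag (left tl)
    right-tag  : tag (right tl) ≡ tag (left tl)
    bottom-tag : tag (bottom tl) ≡ tag (left tl)
    rule       : FamilyRule χ (left tl) (up tl) (right tl) (bottom tl)

TilingBy : (Tile → Set) → (ℤ → ℤ → Tile) → Set
TilingBy S T = (∀ x y → S (T x y)) ×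
               (∀ x y → right (T x y) ≡ left (T (x ℤ.+ 1ℤ) y)) ×
               (∀ x y → up (T x y) ≡ bottom (T x (y ℤ.+ 1ℤ)))

PrefixClosed : (ℕ → ℕ) → Set
PrefixClosed χ = ∀ τ ρ → χ (codeSeq (τ ++ ρ)) ≡ 1 → χ (codeSeq τ) ≡ 1

InfinitePath : (ℕ → ℕ) → Set
InfinitePath χ = Σ (ℕ → ℕ) λ p → ∀ k → χ (codeSeq (applyUpTo p k)) ≡ 1

+1-suc : ∀ n → + n ℤ.+ 1ℤ ≡ + suc n
+1-suc n = cong +_ (+-comm n 1)

shift-invariant⇒constant : ∀ {A : Set} (f : ℤ → A) →
  (∀ z → f (z ℤ.+ 1ℤ) ≡ f z) → ∀ z → f z ≡ f 0ℤ
shift-invariant⇒constant f inv (+ zero) = refl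
shift-invariant⇒constant f inv (+ suc n) =
  trans (cong f (sym (+1-suc n))) (trans (inv (+ n)) (shift-invariant⇒constant f inv (+ n)))
shift-invariant⇒constant f inv -[1+ zero ] = sym (inv -[1+ 0 ])
shift-invariant⇒constant f inv -[1+ suc n ] =
  trans (sym (inv -[1+ suc n ])) (shift-invariant⇒constant f inv -[1+ n ])

-- f z - z is shift invariant.
shift-equivariant⇒translation : ∀ (f : ℤ → ℤ) →
  (∀ z → f (z ℤ.+ 1ℤ) ≡ f z ℤ.+ 1ℤ) → ∀ z → f z ≡ f 0ℤ ℤ.+ z
shift-equivariant⇒translation f equiv z = begin
  f z                       ≡⟨ cancel-− z (f z) ⟩
  (f z ℤ.- z) ℤ.+ z         ≡⟨ cong (ℤ._+ z) (shift-invariant⇒constant offset invariant z) ⟩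
  (f 0ℤ ℤ.- 0ℤ) ℤ.+ z       ≡⟨ cong (ℤ._+ z) (ℤ.+-identityʳ (f 0ℤ)) ⟩
  f 0ℤ ℤ.+ z                ∎
  where
  open ≡-Reasoning
  cancel-− : ∀ b a → a ≡ (a ℤ.- b) ℤ.+ b
  cancel-− = solve-∀
  cancel-+1 : ∀ a b → a ℤ.+ 1ℤ ℤ.- (b ℤ.+ 1ℤ) ≡ a ℤ.- b
  cancel-+1 = solve-∀
  offset : ℤ → ℤ
  offset z = f z ℤ.- z
  invariant : ∀ z → offset (z ℤ.+ 1ℤ) ≡ offset z
  invariant z = begin
    f (z ℤ.+ 1ℤ) ℤ.- (z ℤ.+ 1ℤ)   ≡⟨ cong (ℤ._- (z ℤ.+ 1ℤ)) (equiv z) ⟩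
    f z ℤ.+ 1ℤ ℤ.- (z ℤ.+ 1ℤ)     ≡⟨ cancel-+1 (f z) z ⟩
    f z ℤ.- z                     ∎

invariant²⇒constant : ∀ {A : Set} (f : ℤ → ℤ → A) →
  (∀ x y → f (x ℤ.+ 1ℤ) y ≡ f x y) → (∀ x y → f x (y ℤ.+ 1ℤ) ≡ f x y) →
  ∀ x y → f x y ≡ f 0ℤ 0ℤ
invariant²⇒constant f horizontal vertical x y =
  trans (shift-invariant⇒constant (f x) (vertical x) y)
        (shift-invariant⇒constant (λ x → f x 0ℤ) (λ x → horizontal x 0ℤ) x)

translation-in-x : ∀ (f : ℤ → ℤ → ℤ) →
  (∀ x y → f (x ℤ.+ 1ℤ) y ≡ f x y ℤ.+ 1ℤ) → (∀ x y → f x (y ℤ.+ 1ℤ) ≡ f x y) →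
  ∀ x y → f x y ≡ f 0ℤ 0ℤ ℤ.+ x
translation-in-x f horizontal vertical x y =
  trans (shift-invariant⇒constant (f x) (vertical x) y)
        (shift-equivariant⇒translation (λ x → f x 0ℤ) (λ x → horizontal x 0ℤ) x)

m-1+1≡m : ∀ m → m ℤ.- 1ℤ ℤ.+ 1ℤ ≡ m
m-1+1≡m = solve-∀

∷ʳ-closed⇒++-closed : ∀ {A : Set} (P : List A → Set) → (∀ σ a → P (σ ∷ʳ a) → P σ) →
  ∀ τ ρ → P (τ ++ ρ) → P τ
∷ʳ-closed⇒++-closed P step τ [] h = subst P (++-identityʳ τ) h
∷ʳ-closed⇒++-closed P step τ (a ∷ ρ) h =
  step τ a (∷ʳ-closed⇒++-closed P step (τ ∷ʳ a) ρ (subst P (sym (++-assoc τ [ a ] ρ)) h))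

reverse-applyUpTo-suc : ∀ (p : ℕ → ℕ) n → reverse (applyUpTo p (suc n)) ≡ p n ∷ reverse (applyUpTo p n)
reverse-applyUpTo-suc p n = begin
  reverse (applyUpTo p (suc n))     ≡⟨ cong reverse (applyUpTo-∷ʳ p n) ⟨
  reverse (applyUpTo p n ∷ʳ p n)    ≡⟨ reverse-++ (applyUpTo p n) [ p n ] ⟩
  p n ∷ reverse (applyUpTo p n)     ∎
  where open ≡-Reasoning

codeSeq-reverse-applyUpTo-suc : ∀ (p : ℕ → ℕ) n →
  codeSeq (reverse (applyUpTo p (suc n))) ≡ suc (pair (p n) (codeSeq (reverse (applyUpTo p n))))
codeSeq-reverse-applyUpTo-suc p n = cong codeSeq (reverse-applyUpTo-suc p n)

reverseCode-reverse : ∀ ρ → reverseCode (codeSeq (reverse ρ)) ≡ codeSeq ρ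
reverseCode-reverse ρ = trans (reverseCode-codeSeq (reverse ρ)) (cong codeSeq (reverse-involutive ρ))

uniform-tag-Prototile : ∀ {χ t L U R B} → tag L ≡ t → tag U ≡ t → tag R ≡ t → tag B ≡ t →
  FamilyRule χ L U R B → Prototile χ ⟨ L , U , R , B ⟩
uniform-tag-Prototile L≡t U≡t R≡t B≡t rule = record
  { up-tag = trans U≡t (sym L≡t)
  ; right-tag = trans R≡t (sym L≡t)
  ; bottom-tag = trans B≡t (sym L≡t)
  ; rule = rule
  }

uniform-colour-Prototile : ∀ {χ} t {a₁ b₁ a₂ b₂ a₃ b₃ a₄ b₄} →
  FamilyRule χ (colour t a₁ b₁) (colour t a₂ b₂) (colour t a₃ b₃) (colour t a₄ b₄) →
  Prototile χ ⟨ colour t a₁ b₁ , colour t a₂ b₂ , colour t a₃ b₃ , colour t a₄ b₄ ⟩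
uniform-colour-Prototile t =
  uniform-tag-Prototile (tag-colour t _ _) (tag-colour t _ _) (tag-colour t _ _) (tag-colour t _ _)

x-invariant⇒Periodic : ∀ (T : ℤ → ℤ → Tile) → (∀ x y → T x y ≡ T 0ℤ y) → Periodic T
x-invariant⇒Periodic T invariant = 1ℤ , 0ℤ , (λ { (() , _) }) , λ x y → begin
  T (x ℤ.+ 1ℤ) (y ℤ.+ 0ℤ)  ≡⟨ invariant (x ℤ.+ 1ℤ) (y ℤ.+ 0ℤ) ⟩
  T 0ℤ (y ℤ.+ 0ℤ)          ≡⟨ cong (T 0ℤ) (ℤ.+-identityʳ y) ⟩
  T 0ℤ y                   ≡⟨ invariant x y ⟨
  T x y                    ∎
  where open ≡-Reasoning

counterColour : ℤ → ℤ → ℕ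
counterColour x y = colour 0 (encodeℤ x) (encodeℤ y)

counterTiles : ℤ → ℤ → Tile
counterTiles x y =
  ⟨ counterColour x y , counterColour x (y ℤ.+ 1ℤ) , counterColour (x ℤ.+ 1ℤ) y , counterColour x y ⟩

counterTiling : ∀ χ → TilingBy (Prototile χ) counterTiles
counterTiling χ = tiles , (λ _ _ → refl) , (λ _ _ → refl)
  where
  coordinate₁ : ∀ x y → intOf (slot₁ (counterColour x y)) ≡ x
  coordinate₁ x y = trans (cong intOf (slot₁-colour 0 _ (encodeℤ y))) (intOf-encodeℤ x)
  coordinate₂ : ∀ x y → intOf (slot₂ (counterColour x y)) ≡ y
  coordinate₂ x y = trans (cong intOf (slot₂-colour 0 (encodeℤ x) _)) (intOf-encodeℤ y)
  tiles : ∀ x y → Prototile χ (counterTiles x y)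
  tiles x y = uniform-colour-Prototile 0 (counter (tag-colour 0 _ _) record
    { left≡bottom = refl
    ; right₁ = trans (coordinate₁ (x ℤ.+ 1ℤ) y) (cong (ℤ._+ 1ℤ) (sym (coordinate₁ x y)))
    ; right₂ = trans (coordinate₂ (x ℤ.+ 1ℤ) y) (sym (coordinate₂ x y))
    ; up₁ = trans (coordinate₁ x (y ℤ.+ 1ℤ)) (sym (coordinate₁ x y))
    ; up₂ = trans (coordinate₂ x (y ℤ.+ 1ℤ)) (cong (ℤ._+ 1ℤ) (sym (coordinate₂ x y)))
    })

PathRule-kB-zero : ∀ {χ kU rU kB rB} → PathRule χ kU rU kB rB → kB ≡ 0 →
  Σ ℕ λ m → rU ≡ suc m × kU ≡ 0 × rB ≡ π₂ m × χ (reverseCode (suc m)) ≡ 1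
PathRule-kB-zero (stem _ _ kB≡suc) kB≡0 with () ← trans (sym kB≡0) kB≡suc
PathRule-kB-zero (node m rU≡ kU≡0 _ rB≡ in-tree) _ = m , rU≡ , kU≡0 , rB≡ , in-tree

PathRule-kB-suc : ∀ {χ kU rU kB rB j} → PathRule χ kU rU kB rB → kB ≡ suc j →
  rU ≡ 0 × kU ≡ j
PathRule-kB-suc (stem rU≡0 _ kB≡) kB≡suc = rU≡0 , suc-injective (trans (sym kB≡) kB≡suc)
PathRule-kB-suc (node _ _ _ kB≡0 _ _) kB≡suc with () ← trans (sym kB≡0) kB≡suc

PathRule-rU-suc : ∀ {χ kU rU kB rB m} → PathRule χ kU rU kB rB → rU ≡ suc m →
  kU ≡ 0 × kB ≡ 0 × rB ≡ π₂ m
PathRule-rU-suc (stem rU≡0 _ _) rU≡suc with () ← trans (sym rU≡0) rU≡suc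
PathRule-rU-suc (node _ rU≡suc′ kU≡0 kB≡0 rB≡ _) rU≡suc
  with refl ← suc-injective (trans (sym rU≡suc′) rU≡suc) = kU≡0 , kB≡0 , rB≡

-- The vertical colours of a column of path tiles: k y and r y are the counter
-- and the reversed-sequence code on the bottom edge of the tile at height y.
ColumnLaw : (ℕ → ℕ) → (ℤ → ℕ) → (ℤ → ℕ) → Set
ColumnLaw χ k r = ∀ y → PathRule χ (k (y ℤ.+ 1ℤ)) (r (y ℤ.+ 1ℤ)) (k y) (r y)

RayLaw : (ℕ → ℕ) → (ℕ → ℕ) → (ℕ → ℕ) → Set
RayLaw χ k r = ∀ n → PathRule χ (k (suc n)) (r (suc n)) (k n) (r n)

-- Above a colour with counter 0 and the empty sequence every tile is a node,
-- so the sequence at height n + 1 extends the one at height n by its head p n.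
RayLaw⇒path : ∀ {χ k r} → RayLaw χ k r → k 0 ≡ 0 → r 0 ≡ 0 →
  Σ (ℕ → ℕ) λ p → ∀ n → χ (codeSeq (applyUpTo p (suc n))) ≡ 1
RayLaw⇒path {χ} {k} {r} ray k0 r0 = p , in-tree
  where
  p : ℕ → ℕ
  p n = headCode (r (suc n))
  shape : ∀ n → k n ≡ 0 × r n ≡ codeSeq (reverse (applyUpTo p n))
  shape zero = k0 , r0
  shape (suc n) with PathRule-kB-zero (ray n) (proj₁ (shape n))
  ... | m , rU≡ , kU≡0 , rB≡ , _ = kU≡0 , (begin
    r (suc n)                                              ≡⟨ rU≡ ⟩
    suc m                                                  ≡⟨ cong suc (pair-unpair m) ⟨
    suc (pair (π₁ m) (π₂ m))                               ≡⟨ cong₂ (λ a b → suc (pair a b)) (cong headCode (sym rU≡)) (sym rB≡) ⟩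
    suc (pair (p n) (r n))                                 ≡⟨ cong (λ b → suc (pair (p n) b)) (proj₂ (shape n)) ⟩
    suc (pair (p n) (codeSeq (reverse (applyUpTo p n))))   ≡⟨ codeSeq-reverse-applyUpTo-suc p n ⟨
    codeSeq (reverse (applyUpTo p (suc n)))                ∎)
    where open ≡-Reasoning
  in-tree : ∀ n → χ (codeSeq (applyUpTo p (suc n))) ≡ 1
  in-tree n with PathRule-kB-zero (ray n) (proj₁ (shape n))
  ... | m , rU≡ , _ , _ , χ≡1 = begin
    χ (codeSeq (applyUpTo p (suc n)))                      ≡⟨ cong χ (reverseCode-reverse (applyUpTo p (suc n))) ⟨
    χ (reverseCode (codeSeq (reverse (applyUpTo p (suc n))))) ≡⟨ cong (χ ∘ reverseCode) (trans (sym (proj₂ (shape (suc n)))) rU≡) ⟩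
    χ (reverseCode (suc m))                                ≡⟨ χ≡1 ⟩
    1                                                      ∎
    where open ≡-Reasoning

module _ {χ : ℕ → ℕ} {k r : ℤ → ℕ} (law : ColumnLaw χ k r) where

  private
    law-below : ∀ y → PathRule χ (k y) (r y) (k (y ℤ.- 1ℤ)) (r (y ℤ.- 1ℤ))
    law-below y = subst (λ z → PathRule χ (k z) (r z) (k (y ℤ.- 1ℤ)) (r (y ℤ.- 1ℤ)))
                        (m-1+1≡m y) (law (y ℤ.- 1ℤ))

  Root : Set
  Root = Σ ℤ λ y → k y ≡ 0 × r y ≡ 0

  -- Below a stem the counter grows, so climbing from a stem reaches counter 0.
  climb : ∀ j y → k y ≡ j → r y ≡ 0 → Root
  climb zero y k≡0 r≡0 = y , k≡0 , r≡0
  climb (suc j) y k≡suc _ with PathRule-kB-suc (law y) k≡suc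
  ... | rU≡0 , kU≡j = climb j (y ℤ.+ 1ℤ) kU≡j rU≡0

  -- Below a node the sequence shrinks, so descending through nodes reaches [].
  descend : ∀ fuel y → r y < fuel → k y ≡ 0 → Root
  descend (suc fuel) y r<fuel k≡0 with r y in r≡
  ... | zero = y , k≡0 , r≡
  ... | suc m with PathRule-rU-suc (law-below y) r≡
  ...   | _ , kB≡0 , rB≡ =
    descend fuel (y ℤ.- 1ℤ) (subst (_< fuel) (sym rB≡) (≤-<-trans (π₂-≤ m) (≤-pred r<fuel))) kB≡0

  -- If r 0 > 0, the tile at height -1 is a node, so k 0 is 0.
  root : Root
  root with r 0ℤ in r≡
  ... | zero = climb (k 0ℤ) 0ℤ refl r≡
  ... | suc m = descend (suc (suc m)) 0ℤ (subst (_< suc (suc m)) (sym r≡) ≤-refl)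
                        (proj₁ (PathRule-rU-suc (law -[1+ 0 ]) r≡))

  ColumnLaw⇒path : PrefixClosed χ → InfinitePath χ
  ColumnLaw⇒path closed = p , λ where
      zero → closed [] [ p 0 ] (in-tree 0)
      (suc n) → in-tree n
    where
    y₀ : ℤ
    y₀ = proj₁ root
    k₀ r₀ : ℕ → ℕ
    k₀ n = k (y₀ ℤ.+ + n)
    r₀ n = r (y₀ ℤ.+ + n)
    next : ∀ n → y₀ ℤ.+ + n ℤ.+ 1ℤ ≡ y₀ ℤ.+ + suc n
    next n = trans (ℤ.+-assoc y₀ (+ n) 1ℤ) (cong (λ z → y₀ ℤ.+ z) (+1-suc n))
    ray : RayLaw χ k₀ r₀
    ray n = subst (λ z → PathRule χ (k z) (r z) (k₀ n) (r₀ n)) (next n) (law (y₀ ℤ.+ + n))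
    path-above = RayLaw⇒path ray (trans (cong k (ℤ.+-identityʳ y₀)) (proj₁ (proj₂ root)))
                           (trans (cong r (ℤ.+-identityʳ y₀)) (proj₂ (proj₂ root)))
    p = proj₁ path-above
    in-tree = proj₂ path-above

columnTiles : (ℤ → ℕ) → (ℤ → ℕ) → ℤ → ℤ → Tile
columnTiles k r x y =
  ⟨ colour 1 0 0 , colour 1 (k (y ℤ.+ 1ℤ)) (r (y ℤ.+ 1ℤ)) , colour 1 0 0 , colour 1 (k y) (r y) ⟩

ColumnLaw⇒tiling : ∀ {χ k r} → ColumnLaw χ k r → TilingBy (Prototile χ) (columnTiles k r)
ColumnLaw⇒tiling {χ} {k} {r} law = tiles , (λ _ _ → refl) , (λ _ _ → refl)
  where
  in-slots : ∀ {kU rU kB rB} → PathRule χ kU rU kB rB →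
    PathRule χ (slot₁ (colour 1 kU rU)) (slot₂ (colour 1 kU rU)) (slot₁ (colour 1 kB rB)) (slot₂ (colour 1 kB rB))
  in-slots {kU} {rU} {kB} {rB}
    rewrite slot₁-colour 1 kU rU | slot₂-colour 1 kU rU | slot₁-colour 1 kB rB | slot₂-colour 1 kB rB = λ rule → rule
  tiles : ∀ x y → Prototile χ (columnTiles k r x y)
  tiles x y = uniform-colour-Prototile 1 (path (tag-colour 1 0 0) (in-slots (law y)))

pathCounter pathSequence : (ℕ → ℕ) → ℤ → ℕ
pathCounter p (+ n) = 0
pathCounter p -[1+ n ] = suc n
pathSequence p (+ n) = codeSeq (reverse (applyUpTo p n))
pathSequence p -[1+ n ] = 0

-- Below height 0 a stem counting down to 0; above it the path, one node per step.
path⇒ColumnLaw : ∀ {χ} (p : ℕ → ℕ) → (∀ n → χ (codeSeq (applyUpTo p n)) ≡ 1) →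
  ColumnLaw χ (pathCounter p) (pathSequence p)
path⇒ColumnLaw {χ} p in-tree (+ n) rewrite +-comm n 1 =
  node (pair (p n) (pathSequence p (+ n))) (codeSeq-reverse-applyUpTo-suc p n) refl refl
       (sym (π₂-pair (p n) _))
       (begin
         χ (reverseCode (suc (pair (p n) (pathSequence p (+ n)))))
           ≡⟨ cong (χ ∘ reverseCode) (codeSeq-reverse-applyUpTo-suc p n) ⟨
         χ (reverseCode (codeSeq (reverse (applyUpTo p (suc n)))))
           ≡⟨ cong χ (reverseCode-reverse (applyUpTo p (suc n))) ⟩
         χ (codeSeq (applyUpTo p (suc n)))
           ≡⟨ in-tree (suc n) ⟩
         1 ∎)
  where open ≡-Reasoning
path⇒ColumnLaw p in-tree -[1+ zero ] = stem refl refl refl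
path⇒ColumnLaw p in-tree -[1+ suc n ] = stem refl refl refl

badColour : List ℕ → ℕ → ℕ
badColour σ a = colour 2 0 (codeSeq (a ∷ reverse σ))

badTiling : ∀ {χ σ a} → χ (codeSeq (σ ∷ʳ a)) ≡ 1 → χ (codeSeq σ) ≡ 0 →
  TilingBy (Prototile χ) (λ _ _ → ⟨ badColour σ a , badColour σ a , badColour σ a , badColour σ a ⟩)
badTiling {χ} {σ} {a} extension-in prefix-out =
  (λ _ _ → uniform-colour-Prototile 2
    (bad (tag-colour 2 0 _) (BadRule.bad m (slot₂-colour 2 0 _) extension-in′ prefix-out′))) ,
  (λ _ _ → refl) , (λ _ _ → refl)
  where
  m : ℕ
  m = pair a (codeSeq (reverse σ))
  extension-in′ : χ (reverseCode (suc m)) ≡ 1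
  extension-in′ = begin
    χ (reverseCode (codeSeq (a ∷ reverse σ)))       ≡⟨ cong χ (reverseCode-codeSeq (a ∷ reverse σ)) ⟩
    χ (codeSeq (reverse (a ∷ reverse σ)))           ≡⟨ cong (χ ∘ codeSeq) (unfold-reverse a (reverse σ)) ⟩
    χ (codeSeq (reverse (reverse σ) ∷ʳ a))          ≡⟨ cong (λ τ → χ (codeSeq (τ ∷ʳ a))) (reverse-involutive σ) ⟩
    χ (codeSeq (σ ∷ʳ a))                            ≡⟨ extension-in ⟩
    1                                               ∎
    where open ≡-Reasoning
  prefix-out′ : χ (reverseCode (π₂ m)) ≡ 0
  prefix-out′ = trans (cong (χ ∘ reverseCode) (π₂-pair a _))
                      (trans (cong χ (reverseCode-reverse σ)) prefix-out)

BadRule⇒¬PrefixClosed : ∀ {χ r} → BadRule χ r → ¬ PrefixClosed χ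
BadRule⇒¬PrefixClosed {χ} (bad m _ extension-in prefix-out) closed =
  0≢1+n (trans (sym prefix-out) (trans (cong χ prefix≡) (closed (reverse σ) [ π₁ m ] extension-in′)))
  where
  σ : List ℕ
  σ = decodeSeq (π₂ m)
  extension≡ : reverseCode (suc m) ≡ codeSeq (reverse σ ∷ʳ π₁ m)
  extension≡ = begin
    reverseCode (suc m)                           ≡⟨ cong (reverseCode ∘ suc) (pair-unpair m) ⟨
    reverseCode (suc (pair (π₁ m) (π₂ m)))        ≡⟨ cong (λ b → reverseCode (suc (pair (π₁ m) b))) (codeSeq-decodeSeq (π₂ m)) ⟨
    reverseCode (codeSeq (π₁ m ∷ σ))              ≡⟨ reverseCode-codeSeq (π₁ m ∷ σ) ⟩
    codeSeq (reverse (π₁ m ∷ σ))                  ≡⟨ cong codeSeq (unfold-reverse (π₁ m) σ) ⟩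
    codeSeq (reverse σ ∷ʳ π₁ m)                   ∎
    where open ≡-Reasoning
  extension-in′ : χ (codeSeq (reverse σ ++ [ π₁ m ])) ≡ 1
  extension-in′ = trans (cong χ (sym extension≡)) extension-in
  prefix≡ : reverseCode (π₂ m) ≡ codeSeq (reverse σ)
  prefix≡ = trans (cong reverseCode (sym (codeSeq-decodeSeq (π₂ m)))) (reverseCode-codeSeq σ)

module _ {χ : ℕ → ℕ} {T : ℤ → ℤ → Tile} (tiling : TilingBy (Prototile χ) T) where

  private
    tile = proj₁ tiling
    horizontal = proj₁ (proj₂ tiling)
    vertical = proj₂ (proj₂ tiling)

  tagAt : ℤ → ℤ → ℕ
  tagAt x y = tag (left (T x y))

  tagAt-constant : ∀ x y → tagAt x y ≡ tagAt 0ℤ 0ℤ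
  tagAt-constant = invariant²⇒constant tagAt
    (λ x y → trans (cong tag (sym (horizontal x y))) (Prototile.right-tag (tile x y)))
    (λ x y → trans (sym (Prototile.bottom-tag (tile x (y ℤ.+ 1ℤ))))
                   (trans (cong tag (sym (vertical x y))) (Prototile.up-tag (tile x y))))

  counterRuleAt : tagAt 0ℤ 0ℤ ≡ 0 → ∀ x y →
    CounterRule (left (T x y)) (up (T x y)) (right (T x y)) (bottom (T x y))
  counterRuleAt tag≡0 x y with Prototile.rule (tile x y) | trans (tagAt-constant x y) tag≡0
  ... | counter _ rule | _ = rule
  ... | path tag≡1 _ | tag≡0′ with () ← trans (sym tag≡1) tag≡0′
  ... | bad tag≡2 _ | tag≡0′ with () ← trans (sym tag≡2) tag≡0′

  pathRuleAt : tagAt 0ℤ 0ℤ ≡ 1 → ∀ x y →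
    PathRule χ (slot₁ (up (T x y))) (slot₂ (up (T x y))) (slot₁ (bottom (T x y))) (slot₂ (bottom (T x y)))
  pathRuleAt tag≡1 x y with Prototile.rule (tile x y) | trans (tagAt-constant x y) tag≡1
  ... | counter tag≡0 _ | tag≡1′ with () ← trans (sym tag≡0) tag≡1′
  ... | path _ rule | _ = rule
  ... | bad tag≡2 _ | tag≡1′ with () ← trans (sym tag≡2) tag≡1′

  -- The two slots of the left colours are coordinates: they increase by one
  -- to the right and upwards respectively, so no translation fixes the tiling.
  counter-aperiodic : tagAt 0ℤ 0ℤ ≡ 0 → ¬ Periodic T
  counter-aperiodic tag≡0 (a , b , nonzero , period) = nonzero (a≡0 , b≡0)
    where
    open CounterRule
    rule = counterRuleAt tag≡0
    abscissa ordinate : ℤ → ℤ → ℤ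
    abscissa x y = intOf (slot₁ (left (T x y)))
    ordinate x y = intOf (slot₂ (left (T x y)))
    left-above≡up : ∀ (slot : ℕ → ℕ) x y →
      intOf (slot (left (T x (y ℤ.+ 1ℤ)))) ≡ intOf (slot (up (T x y)))
    left-above≡up slot x y =
      cong (intOf ∘ slot) (trans (left≡bottom (rule x (y ℤ.+ 1ℤ))) (sym (vertical x y)))
    bottom≡left : ∀ (slot : ℕ → ℕ) x y → intOf (slot (bottom (T x y))) ≡ intOf (slot (left (T x y)))
    bottom≡left slot x y = cong (intOf ∘ slot) (sym (left≡bottom (rule x y)))
    abscissa-linear : ∀ x y → abscissa x y ≡ abscissa 0ℤ 0ℤ ℤ.+ x
    abscissa-linear = translation-in-x abscissa
      (λ x y → trans (cong (intOf ∘ slot₁) (sym (horizontal x y))) (right₁ (rule x y)))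
      (λ x y → trans (left-above≡up slot₁ x y) (trans (up₁ (rule x y)) (bottom≡left slot₁ x y)))
    ordinate-linear : ∀ x y → ordinate x y ≡ ordinate 0ℤ 0ℤ ℤ.+ y
    ordinate-linear x y = translation-in-x (λ y x → ordinate x y)
      (λ y x → trans (left-above≡up slot₂ x y) (trans (up₂ (rule x y)) (cong (ℤ._+ 1ℤ) (bottom≡left slot₂ x y))))
      (λ y x → trans (cong (intOf ∘ slot₂) (sym (horizontal x y))) (right₂ (rule x y)))
      y x
    shifted : T a b ≡ T 0ℤ 0ℤ
    shifted = trans (cong₂ T (sym (ℤ.+-identityˡ a)) (sym (ℤ.+-identityˡ b))) (period 0ℤ 0ℤ)
    a≡0 : a ≡ 0ℤ
    a≡0 = identityʳ-unique (abscissa 0ℤ 0ℤ) a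
            (trans (sym (abscissa-linear a b)) (cong (λ t → intOf (slot₁ (left t))) shifted))
    b≡0 : b ≡ 0ℤ
    b≡0 = identityʳ-unique (ordinate 0ℤ 0ℤ) b
            (trans (sym (ordinate-linear a b)) (cong (λ t → intOf (slot₂ (left t))) shifted))

  pathFamily⇒ColumnLaw : tagAt 0ℤ 0ℤ ≡ 1 →
    ColumnLaw χ (λ y → slot₁ (bottom (T 0ℤ y))) (λ y → slot₂ (bottom (T 0ℤ y)))
  pathFamily⇒ColumnLaw tag≡1 y =
    subst (λ U → PathRule χ (slot₁ U) (slot₂ U) (slot₁ (bottom (T 0ℤ y))) (slot₂ (bottom (T 0ℤ y))))
          (vertical 0ℤ y) (pathRuleAt tag≡1 0ℤ y)

Prototile-aperiodic : ∀ {χ T} → PrefixClosed χ → ¬ InfinitePath χ →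
  TilingBy (Prototile χ) T → ¬ Periodic T
Prototile-aperiodic closed no-path tiling with Prototile.rule (proj₁ tiling 0ℤ 0ℤ)
... | counter tag≡0 _ = counter-aperiodic tiling tag≡0
... | path tag≡1 _ = λ _ → no-path (ColumnLaw⇒path (pathFamily⇒ColumnLaw tiling tag≡1) closed)
... | bad _ rule = λ _ → BadRule⇒¬PrefixClosed rule closed

PeriodicallyTileable : (ℕ → ℕ) → Set
PeriodicallyTileable χ = Σ (ℤ → ℤ → Tile) λ T → TilingBy (Prototile χ) T × Periodic T

path⇒PeriodicallyTileable : ∀ {χ} → InfinitePath χ → PeriodicallyTileable χ
path⇒PeriodicallyTileable (p , in-tree) =
  columnTiles (pathCounter p) (pathSequence p) ,
  ColumnLaw⇒tiling (path⇒ColumnLaw p in-tree) ,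
  x-invariant⇒Periodic _ (λ _ _ → refl)

¬PrefixClosed⇒PeriodicallyTileable : ∀ {χ σ a} → χ (codeSeq (σ ∷ʳ a)) ≡ 1 → χ (codeSeq σ) ≡ 0 →
  PeriodicallyTileable χ
¬PrefixClosed⇒PeriodicallyTileable extension-in prefix-out =
  _ , badTiling extension-in prefix-out , x-invariant⇒Periodic _ (λ _ _ → refl)

-- Deciding the prototile rules

m+n≡0⇒m≡0×n≡0 : ∀ {m n} → m + n ≡ 0 → m ≡ 0 × n ≡ 0
m+n≡0⇒m≡0×n≡0 {m} eq = m+n≡0⇒m≡0 m eq , m+n≡0⇒n≡0 m eq

m≡0⇒n≡0⇒m+n≡0 : ∀ {m n} → m ≡ 0 → n ≡ 0 → m + n ≡ 0
m≡0⇒n≡0⇒m+n≡0 refl refl = refl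

-- Both sides are + (m + q) and + (p + n + k) shifted by + n ℤ.+ + q.
m+q≡p+n+k⇔m-n≡p-q+k : ∀ m n p q k → (m + q ≡ p + n + k) ⇔ (+ m ℤ.- + n ≡ + p ℤ.- + q ℤ.+ + k)
m+q≡p+n+k⇔m-n≡p-q+k m n p q k = mk⇔
  (λ eq → ∙-cancelʳ shift _ _ (trans lhs (trans (cong +_ eq) (sym rhs))))
  (λ eq → ℤ.+-injective (trans (sym lhs) (trans (cong (ℤ._+ shift) eq) rhs)))
  where
  shift : ℤ
  shift = + n ℤ.+ + q
  lhs : (+ m ℤ.- + n) ℤ.+ shift ≡ + (m + q)
  lhs = trans (cancel (+ m) (+ n) (+ q)) (sym (ℤ.pos-+ m q))
    where
    cancel : ∀ m n q → (m ℤ.- n) ℤ.+ (n ℤ.+ q) ≡ m ℤ.+ q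
    cancel = solve-∀
  rhs : (+ p ℤ.- + q ℤ.+ + k) ℤ.+ shift ≡ + (p + n + k)
  rhs = trans (cancel (+ p) (+ q) (+ k) (+ n))
                (sym (trans (ℤ.pos-+ (p + n) k) (cong (ℤ._+ + k) (ℤ.pos-+ p n))))
    where
    cancel : ∀ p q k n → (p ℤ.- q ℤ.+ k) ℤ.+ (n ℤ.+ q) ≡ p ℤ.+ n ℤ.+ k
    cancel = solve-∀

-- Each defect is a sum of distances, zero exactly when the equations of the
-- corresponding rule hold; this is how the checker program decides the rules.
diffDefect : ℕ → ℕ → ℕ → ℕ
diffDefect a b k = dist (π₁ a + π₂ b) (π₁ b + π₂ a + k)

diffDefect≡0⇔ : ∀ a b k → diffDefect a b k ≡ 0 ⇔ (intOf a ≡ intOf b ℤ.+ + k)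
diffDefect≡0⇔ a b k = mk⇔
  (λ eq → Equivalence.to (m+q≡p+n+k⇔m-n≡p-q+k (π₁ a) (π₂ a) (π₁ b) (π₂ b) k) (dist≡0⇒≡ _ _ eq))
  (λ eq → ≡⇒dist≡0 (Equivalence.from (m+q≡p+n+k⇔m-n≡p-q+k (π₁ a) (π₂ a) (π₁ b) (π₂ b) k) eq))

counterDefect : ℕ → ℕ → ℕ → ℕ → ℕ
counterDefect L U R B =
  dist L B + diffDefect (slot₁ R) (slot₁ L) 1 + diffDefect (slot₂ R) (slot₂ L) 0 +
  diffDefect (slot₁ U) (slot₁ B) 0 + diffDefect (slot₂ U) (slot₂ B) 1

counterDefect≡0⇔ : ∀ L U R B → counterDefect L U R B ≡ 0 ⇔ CounterRule L U R B
counterDefect≡0⇔ L U R B = mk⇔ to from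
  where
  open CounterRule
  to : counterDefect L U R B ≡ 0 → CounterRule L U R B
  to eq =
    let (eq₁₂₃₄ , eq₅) = m+n≡0⇒m≡0×n≡0 eq
        (eq₁₂₃ , eq₄) = m+n≡0⇒m≡0×n≡0 eq₁₂₃₄
        (eq₁₂ , eq₃) = m+n≡0⇒m≡0×n≡0 eq₁₂₃
        (eq₁ , eq₂) = m+n≡0⇒m≡0×n≡0 eq₁₂
    in record
      { left≡bottom = dist≡0⇒≡ L B eq₁
      ; right₁ = Equivalence.to (diffDefect≡0⇔ (slot₁ R) (slot₁ L) 1) eq₂
      ; right₂ = trans (Equivalence.to (diffDefect≡0⇔ (slot₂ R) (slot₂ L) 0) eq₃) (ℤ.+-identityʳ _)
      ; up₁ = trans (Equivalence.to (diffDefect≡0⇔ (slot₁ U) (slot₁ B) 0) eq₄) (ℤ.+-identityʳ _)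
      ; up₂ = Equivalence.to (diffDefect≡0⇔ (slot₂ U) (slot₂ B) 1) eq₅
      }
  from : CounterRule L U R B → counterDefect L U R B ≡ 0
  from rule =
    m≡0⇒n≡0⇒m+n≡0
      (m≡0⇒n≡0⇒m+n≡0
        (m≡0⇒n≡0⇒m+n≡0
          (m≡0⇒n≡0⇒m+n≡0 (≡⇒dist≡0 (left≡bottom rule))
                         (Equivalence.from (diffDefect≡0⇔ (slot₁ R) (slot₁ L) 1) (right₁ rule)))
          (Equivalence.from (diffDefect≡0⇔ (slot₂ R) (slot₂ L) 0) (trans (right₂ rule) (sym (ℤ.+-identityʳ _)))))
        (Equivalence.from (diffDefect≡0⇔ (slot₁ U) (slot₁ B) 0) (trans (up₁ rule) (sym (ℤ.+-identityʳ _)))))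
      (Equivalence.from (diffDefect≡0⇔ (slot₂ U) (slot₂ B) 1) (up₂ rule))

pathDefect : (kU rU kB rB v : ℕ) → ℕ
pathDefect kU rU kB rB v =
  ifz rU (dist rB 0 + dist kB (suc kU)) (kU + kB + dist (tailCode rU) rB + dist v 1)

pathDefect≡0⇔ : ∀ χ kU rU kB rB →
  pathDefect kU rU kB rB (χ (reverseCode rU)) ≡ 0 ⇔ PathRule χ kU rU kB rB
pathDefect≡0⇔ χ kU zero kB rB = mk⇔
  (λ eq → let (eq₁ , eq₂) = m+n≡0⇒m≡0×n≡0 eq
          in stem refl (dist≡0⇒≡ rB 0 eq₁) (dist≡0⇒≡ kB (suc kU) eq₂))
  λ where
    (stem _ refl refl) → ≡⇒dist≡0 {suc kU} refl
    (node _ () _ _ _ _)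
pathDefect≡0⇔ χ kU (suc m) kB rB = mk⇔
  (λ eq → let (eq₁₂₃ , eq₄) = m+n≡0⇒m≡0×n≡0 eq
              (eq₁₂ , eq₃) = m+n≡0⇒m≡0×n≡0 eq₁₂₃
              (eq₁ , eq₂) = m+n≡0⇒m≡0×n≡0 eq₁₂
          in node m refl eq₁ eq₂ (sym (dist≡0⇒≡ (π₂ m) rB eq₃)) (dist≡0⇒≡ _ 1 eq₄))
  λ where
    (stem () _ _)
    (node _ refl refl refl refl in-tree) → m≡0⇒n≡0⇒m+n≡0 (≡⇒dist≡0 {π₂ m} refl) (≡⇒dist≡0 in-tree)

badDefect : (r v₁ v₂ : ℕ) → ℕ
badDefect r v₁ v₂ = ifz r 1 (dist v₁ 1 + v₂)

badDefect≡0⇔ : ∀ χ r →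
  badDefect r (χ (reverseCode r)) (χ (reverseCode (tailCode r))) ≡ 0 ⇔ BadRule χ r
badDefect≡0⇔ χ zero = mk⇔ (λ ()) λ { (bad _ () _ _) }
badDefect≡0⇔ χ (suc m) = mk⇔
  (λ eq → let (eq₁ , eq₂) = m+n≡0⇒m≡0×n≡0 eq in bad m refl (dist≡0⇒≡ _ 1 eq₁) eq₂)
  λ { (bad _ refl in-tree out-of-tree) → m≡0⇒n≡0⇒m+n≡0 (≡⇒dist≡0 in-tree) out-of-tree }

familyDefect : (t c p b : ℕ) → ℕ
familyDefect t c p b = ifz t c (ifz (pred t) p (ifz (pred (pred t)) b 1))

familyDefect≡0⇔ : ∀ t c p b →
  familyDefect t c p b ≡ 0 ⇔ ((t ≡ 0 × c ≡ 0) ⊎ (t ≡ 1 × p ≡ 0) ⊎ (t ≡ 2 × b ≡ 0))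
familyDefect≡0⇔ t c p b = mk⇔ (to t) from
  where
  to : ∀ t → familyDefect t c p b ≡ 0 → (t ≡ 0 × c ≡ 0) ⊎ (t ≡ 1 × p ≡ 0) ⊎ (t ≡ 2 × b ≡ 0)
  to 0 eq = inj₁ (refl , eq)
  to 1 eq = inj₂ (inj₁ (refl , eq))
  to 2 eq = inj₂ (inj₂ (refl , eq))
  from : (t ≡ 0 × c ≡ 0) ⊎ (t ≡ 1 × p ≡ 0) ⊎ (t ≡ 2 × b ≡ 0) → familyDefect t c p b ≡ 0
  from (inj₁ (refl , eq)) = eq
  from (inj₂ (inj₁ (refl , eq))) = eq
  from (inj₂ (inj₂ (refl , eq))) = eq

defect : (L U R B v₁ v₂ : ℕ) → ℕ
defect L U R B v₁ v₂ =
  dist (tag U) (tag L) + dist (tag R) (tag L) + dist (tag B) (tag L) +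
  familyDefect (tag L) (counterDefect L U R B)
    (pathDefect (slot₁ U) (slot₂ U) (slot₁ B) (slot₂ B) v₁) (badDefect (slot₂ U) v₁ v₂)

tileDefect : (ℕ → ℕ) → Tile → ℕ
tileDefect χ tl = defect (left tl) (up tl) (right tl) (bottom tl)
  (χ (reverseCode (slot₂ (up tl)))) (χ (reverseCode (tailCode (slot₂ (up tl)))))

tileDefect≡0⇔Prototile : ∀ χ tl → tileDefect χ tl ≡ 0 ⇔ Prototile χ tl
tileDefect≡0⇔Prototile χ ⟨ L , U , R , B ⟩ = mk⇔ to from
  where
  v₁ v₂ : ℕ
  v₁ = χ (reverseCode (slot₂ U))
  v₂ = χ (reverseCode (tailCode (slot₂ U)))
  family⇔ = familyDefect≡0⇔ (tag L) (counterDefect L U R B)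
              (pathDefect (slot₁ U) (slot₂ U) (slot₁ B) (slot₂ B) v₁) (badDefect (slot₂ U) v₁ v₂)
  to : tileDefect χ ⟨ L , U , R , B ⟩ ≡ 0 → Prototile χ ⟨ L , U , R , B ⟩
  to eq =
    let (eq₁₂₃ , eq₄) = m+n≡0⇒m≡0×n≡0 eq
        (eq₁₂ , eq₃) = m+n≡0⇒m≡0×n≡0 eq₁₂₃
        (eq₁ , eq₂) = m+n≡0⇒m≡0×n≡0 eq₁₂
    in record
      { up-tag = dist≡0⇒≡ _ _ eq₁
      ; right-tag = dist≡0⇒≡ _ _ eq₂
      ; bottom-tag = dist≡0⇒≡ _ _ eq₃
      ; rule = rule (Equivalence.to family⇔ eq₄)
      }
    where
    rule : _ → FamilyRule χ L U R B
    rule (inj₁ (tag≡0 , eq)) = counter tag≡0 (Equivalence.to (counterDefect≡0⇔ L U R B) eq)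
    rule (inj₂ (inj₁ (tag≡1 , eq))) = path tag≡1 (Equivalence.to (pathDefect≡0⇔ χ _ _ _ _) eq)
    rule (inj₂ (inj₂ (tag≡2 , eq))) = bad tag≡2 (Equivalence.to (badDefect≡0⇔ χ _) eq)
  from : Prototile χ ⟨ L , U , R , B ⟩ → tileDefect χ ⟨ L , U , R , B ⟩ ≡ 0
  from record { up-tag = up-tag ; right-tag = right-tag ; bottom-tag = bottom-tag ; rule = rule } =
    m≡0⇒n≡0⇒m+n≡0
      (m≡0⇒n≡0⇒m+n≡0 (m≡0⇒n≡0⇒m+n≡0 (≡⇒dist≡0 up-tag) (≡⇒dist≡0 right-tag)) (≡⇒dist≡0 bottom-tag))
      (Equivalence.from family⇔ (family rule))
    where
    family : FamilyRule χ L U R B → _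
    family (counter tag≡0 rule) = inj₁ (tag≡0 , Equivalence.from (counterDefect≡0⇔ L U R B) rule)
    family (path tag≡1 rule) = inj₂ (inj₁ (tag≡1 , Equivalence.from (pathDefect≡0⇔ χ _ _ _ _) rule))
    family (bad tag≡2 rule) = inj₂ (inj₂ (tag≡2 , Equivalence.from (badDefect≡0⇔ χ _) rule))

-- The penalty 2 (v₁ ∸ 1) leaves {0, 1} whenever v₁ > 1, so if the tile set has
-- a characteristic function, φ_e is {0,1}-valued at every first query.
tileCheck : (L U R B v₁ v₂ : ℕ) → ℕ
tileCheck L U R B v₁ v₂ = (1 ∸ defect L U R B v₁ v₂) + ((v₁ ∸ 1) + (v₁ ∸ 1))

tagᴾ slot₁ᴾ slot₂ᴾ : Program → Program
tagᴾ c = fstᴾ ∘ᴾ c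
slot₁ᴾ c = fstᴾ ∘ᴾ sndᴾ ∘ᴾ c
slot₂ᴾ c = sndᴾ ∘ᴾ sndᴾ ∘ᴾ c

diffDefectᴾ : Program → Program → ℕ → Program
diffDefectᴾ a b k = distᴾ (fstᴾ ∘ᴾ a +ᴾ sndᴾ ∘ᴾ b) (fstᴾ ∘ᴾ b +ᴾ sndᴾ ∘ᴾ a +ᴾ constᴾ k)

counterDefectᴾ : (L U R B : Program) → Program
counterDefectᴾ L U R B =
  distᴾ L B +ᴾ diffDefectᴾ (slot₁ᴾ R) (slot₁ᴾ L) 1 +ᴾ diffDefectᴾ (slot₂ᴾ R) (slot₂ᴾ L) 0 +ᴾ
  diffDefectᴾ (slot₁ᴾ U) (slot₁ᴾ B) 0 +ᴾ diffDefectᴾ (slot₂ᴾ U) (slot₂ᴾ B) 1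

pathDefectᴾ : (kU rU kB rB v : Program) → Program
pathDefectᴾ kU rU kB rB v =
  ifzᴾ rU (distᴾ rB (constᴾ 0) +ᴾ distᴾ kB (sucᴾ ∘ᴾ kU))
          (kU +ᴾ kB +ᴾ distᴾ (tailᴾ ∘ᴾ rU) rB +ᴾ distᴾ v (constᴾ 1))

badDefectᴾ : (r v₁ v₂ : Program) → Program
badDefectᴾ r v₁ v₂ = ifzᴾ r (constᴾ 1) (distᴾ v₁ (constᴾ 1) +ᴾ v₂)

familyDefectᴾ : (t c p b : Program) → Program
familyDefectᴾ t c p b = ifzᴾ t c (ifzᴾ (predᴾ t) p (ifzᴾ (predᴾ (predᴾ t)) b (constᴾ 1)))

defectᴾ : (L U R B v₁ v₂ : Program) → Program
defectᴾ L U R B v₁ v₂ =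
  distᴾ (tagᴾ U) (tagᴾ L) +ᴾ distᴾ (tagᴾ R) (tagᴾ L) +ᴾ distᴾ (tagᴾ B) (tagᴾ L) +ᴾ
  familyDefectᴾ (tagᴾ L) (counterDefectᴾ L U R B)
    (pathDefectᴾ (slot₁ᴾ U) (slot₂ᴾ U) (slot₁ᴾ B) (slot₂ᴾ B) v₁) (badDefectᴾ (slot₂ᴾ U) v₁ v₂)

tileCheckᴾ : (L U R B v₁ v₂ : Program) → Program
tileCheckᴾ L U R B v₁ v₂ = (constᴾ 1 ∸ᴾ defectᴾ L U R B v₁ v₂) +ᴾ ((v₁ ∸ᴾ constᴾ 1) +ᴾ (v₁ ∸ᴾ constᴾ 1))

-- Input ⟨t, ⟨v₁, v₂⟩⟩ with t = ⟨L, ⟨U, ⟨R, B⟩⟩⟩ the code of a tile.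
checkerᴾ : Program
checkerᴾ = tileCheckᴾ
  (fstᴾ ∘ᴾ fstᴾ) (fstᴾ ∘ᴾ sndᴾ ∘ᴾ fstᴾ) (fstᴾ ∘ᴾ sndᴾ ∘ᴾ sndᴾ ∘ᴾ fstᴾ) (sndᴾ ∘ᴾ sndᴾ ∘ᴾ sndᴾ ∘ᴾ fstᴾ)
  (fstᴾ ∘ᴾ sndᴾ) (sndᴾ ∘ᴾ sndᴾ)

-- Opaque so that unification never unfolds the checker program.
opaque
  check : ℕ → ℕ → ℕ → ℕ
  check t v₁ v₂ = run checkerᴾ (pair t (pair v₁ v₂))

  check-evaluates : ∀ t v₁ v₂ → Eval (code checkerᴾ) (pair t (pair v₁ v₂)) (check t v₁ v₂)
  check-evaluates t v₁ v₂ = evaluates checkerᴾ (pair t (pair v₁ v₂))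

  check-tile : ∀ tl v₁ v₂ → check (encodeTile tl) v₁ v₂ ≡ tileCheck (left tl) (up tl) (right tl) (bottom tl) v₁ v₂
  check-tile ⟨ L , U , R , B ⟩ v₁ v₂
    rewrite unpair-pair (encodeTile ⟨ L , U , R , B ⟩) (pair v₁ v₂) | unpair-pair v₁ v₂
          | unpair-pair L (pair U (pair R B)) | unpair-pair U (pair R B) | unpair-pair R B = refl

upSequenceᴾ : Program
upSequenceᴾ = sndᴾ ∘ᴾ sndᴾ ∘ᴾ fstᴾ ∘ᴾ sndᴾ

query₁ᴾ query₂ᴾ : Program
query₁ᴾ = reverseᴾ ∘ᴾ upSequenceᴾ
query₂ᴾ = reverseᴾ ∘ᴾ tailᴾ ∘ᴾ upSequenceᴾ

run-upSequence : ∀ tl → run upSequenceᴾ (encodeTile tl) ≡ slot₂ (up tl)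
run-upSequence ⟨ L , U , R , B ⟩
  rewrite unpair-pair L (pair U (pair R B)) | unpair-pair U (pair R B) = refl

tilesetCode : Code → Code
tilesetCode c =
  compC (code checkerᴾ) (pairC idC (pairC (compC c (code query₁ᴾ)) (compC c (code query₂ᴾ))))

Eval-tilesetCode⇒ : ∀ c t out → Eval (tilesetCode c) t out →
  Σ ℕ λ v₁ → Σ ℕ λ v₂ → Eval c (run query₁ᴾ t) v₁ × Eval c (run query₂ᴾ t) v₂ ×
    out ≡ check t v₁ v₂
Eval-tilesetCode⇒ c t out (ev-comp (ev-pair (ev-id _) (ev-pair (ev-comp q₁ c₁) (ev-comp q₂ c₂))) checked)
  with refl ← Eval-deterministic q₁ (evaluates query₁ᴾ t) refl
     | refl ← Eval-deterministic q₂ (evaluates query₂ᴾ t) refl =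
  _ , _ , c₁ , c₂ , Eval-deterministic checked (check-evaluates t _ _) refl

Eval-tilesetCode⇐ : ∀ c t v₁ v₂ → Eval c (run query₁ᴾ t) v₁ → Eval c (run query₂ᴾ t) v₂ →
  Eval (tilesetCode c) t (check t v₁ v₂)
Eval-tilesetCode⇐ c t v₁ v₂ c₁ c₂ =
  ev-comp (ev-pair (ev-id t) (ev-pair (ev-comp (evaluates query₁ᴾ t) c₁) (ev-comp (evaluates query₂ᴾ t) c₂)))
          (check-evaluates t v₁ v₂)

tilesetᴾ : Program
tilesetᴾ =
  ⟨ constᴾ 5 , ⟨ quoteᴾ (code checkerᴾ) , ⟨ constᴾ 6 , ⟨ quoteᴾ idC ,
  ⟨ constᴾ 6 , ⟨ ⟨ constᴾ 5 , ⟨ idᴾ , quoteᴾ (code query₁ᴾ) ⟩ᴾ ⟩ᴾ ,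
                 ⟨ constᴾ 5 , ⟨ idᴾ , quoteᴾ (code query₂ᴾ) ⟩ᴾ ⟩ᴾ ⟩ᴾ ⟩ᴾ ⟩ᴾ ⟩ᴾ ⟩ᴾ ⟩ᴾ

-- Opaque so that the large code is never unfolded.
opaque
  tileset : ℕ → ℕ
  tileset e =
    pair 5 (pair (encode (code checkerᴾ)) (pair 6 (pair (encode idC)
      (pair 6 (pair (pair 5 (pair e (encode (code query₁ᴾ)))) (pair 5 (pair e (encode (code query₂ᴾ)))))))))

  tileset-evaluates : ∀ e → Eval (code tilesetᴾ) e (tileset e)
  tileset-evaluates = evaluates tilesetᴾ

  decode-tileset : ∀ e → decode (tileset e) ≡ tilesetCode (decode e)
  decode-tileset e = begin
    decode (tileset e)
      ≡⟨ decode-compC _ _ ⟩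
    compC (decode (encode (code checkerᴾ))) (decode (pair 6 (pair (encode idC) query-pair)))
      ≡⟨ cong₂ compC (decode-encode _) (decode-pairC _ _) ⟩
    compC (code checkerᴾ) (pairC (decode (encode idC)) (decode query-pair))
      ≡⟨ cong₂ (λ a b → compC (code checkerᴾ) (pairC a b)) (decode-encode idC) (decode-pairC _ _) ⟩
    compC (code checkerᴾ) (pairC idC (pairC (decode (query query₁ᴾ)) (decode (query query₂ᴾ))))
      ≡⟨ cong₂ (λ a b → compC (code checkerᴾ) (pairC idC (pairC a b))) (decode-query query₁ᴾ) (decode-query query₂ᴾ) ⟩
    tilesetCode (decode e) ∎
    where
    open ≡-Reasoning
    query : Program → ℕ
    query q = pair 5 (pair e (encode (code q)))
    query-pair : ℕ
    query-pair = pair 6 (pair (query query₁ᴾ) (query query₂ᴾ))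
    decode-query : ∀ q → decode (query q) ≡ compC (decode e) (code q)
    decode-query q = trans (decode-compC e _) (cong (compC (decode e)) (decode-encode (code q)))

-- The reduction

decodeTile : ℕ → Tile
decodeTile t = ⟨ π₁ t , π₁ (π₂ t) , π₁ (π₂ (π₂ t)) , π₂ (π₂ (π₂ t)) ⟩

encodeTile-decodeTile : ∀ t → encodeTile (decodeTile t) ≡ t
encodeTile-decodeTile t
  rewrite pair-unpair (π₂ (π₂ t)) | pair-unpair (π₂ t) = pair-unpair t

TilingBy-map : ∀ {S S′ T} → (∀ tl → S tl → S′ tl) → TilingBy S T → TilingBy S′ T
TilingBy-map f (tiles , horizontal , vertical) = (λ x y → f _ (tiles x y)) , horizontal , vertical

1∸n≡0⊎1∸n≡1 : ∀ n → 1 ∸ n ≡ 0 ⊎ 1 ∸ n ≡ 1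
1∸n≡0⊎1∸n≡1 zero = inj₂ refl
1∸n≡0⊎1∸n≡1 (suc n) = inj₁ (0∸n≡0 n)

1∸n≡1⇔n≡0 : ∀ n → 1 ∸ n ≡ 1 ⇔ n ≡ 0
1∸n≡1⇔n≡0 zero = mk⇔ (λ _ → refl) (λ _ → refl)
1∸n≡1⇔n≡0 (suc n) = mk⇔ (λ eq → ⊥-elim (0≢1+n (trans (sym (0∸n≡0 n)) eq))) (λ ())

≤1⇒≡0⊎≡1 : ∀ {n} → n ≤ 1 → n ≡ 0 ⊎ n ≡ 1
≤1⇒≡0⊎≡1 z≤n = inj₁ refl
≤1⇒≡0⊎≡1 (s≤s z≤n) = inj₂ refl

≡0⊎≡1⇒≤1 : ∀ {n} → n ≡ 0 ⊎ n ≡ 1 → n ≤ 1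
≡0⊎≡1⇒≤1 (inj₁ refl) = z≤n
≡0⊎≡1⇒≤1 (inj₂ refl) = ≤-refl

m+[n+n]≤1⇒n≡0 : ∀ m n → m + (n + n) ≤ 1 → n ≡ 0
m+[n+n]≤1⇒n≡0 m zero _ = refl
m+[n+n]≤1⇒n≡0 m (suc n) le with ≤-trans (m≤n+m (suc n + suc n) m) le
... | s≤s n+1+n≤0 with () ← ≤-trans (≤-reflexive (sym (+-suc n n))) n+1+n≤0

tileCheck≤1⇒v₁≤1 : ∀ L U R B v₁ v₂ → tileCheck L U R B v₁ v₂ ≤ 1 → v₁ ≤ 1
tileCheck≤1⇒v₁≤1 L U R B v₁ v₂ check≤1 =
  m∸n≡0⇒m≤n (m+[n+n]≤1⇒n≡0 (1 ∸ defect L U R B v₁ v₂) (v₁ ∸ 1) check≤1)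

tileCheck-boolean : ∀ L U R B v₁ v₂ → v₁ ≤ 1 → tileCheck L U R B v₁ v₂ ≡ 1 ∸ defect L U R B v₁ v₂
tileCheck-boolean L U R B v₁ v₂ v₁≤1 rewrite m≤n⇒m∸n≡0 v₁≤1 = +-identityʳ _

module _ {e : ℕ} (charFn : CharFn e) where

  χ : ℕ → ℕ
  χ x = proj₁ (charFn x)

  Φ-χ : ∀ x → Φ e x (χ x)
  Φ-χ x = proj₁ (proj₂ (charFn x))

  Φ⇔χ : ∀ x v → Φ e x v ⇔ χ x ≡ v
  Φ⇔χ x v = mk⇔ (λ Φxv → Eval-deterministic (Φ-χ x) Φxv refl) (λ { refl → Φ-χ x })

  χ≤1 : ∀ x → χ x ≤ 1
  χ≤1 x = ≡0⊎≡1⇒≤1 (proj₂ (proj₂ (charFn x)))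

  tilesetAnswer : ℕ → ℕ
  tilesetAnswer t = check t (χ (run query₁ᴾ t)) (χ (run query₂ᴾ t))

  Φ-tileset⇔ : ∀ t out → Φ (tileset e) t out ⇔ out ≡ tilesetAnswer t
  Φ-tileset⇔ t out = mk⇔ to from
    where
    to : Φ (tileset e) t out → out ≡ tilesetAnswer t
    to Φt =
      let (v₁ , v₂ , Φv₁ , Φv₂ , out≡) =
            Eval-tilesetCode⇒ (decode e) t out (subst (λ c → Eval c t out) (decode-tileset e) Φt)
      in trans out≡ (cong₂ (check t) (sym (Equivalence.to (Φ⇔χ _ v₁) Φv₁))
                                     (sym (Equivalence.to (Φ⇔χ _ v₂) Φv₂)))
    from : out ≡ tilesetAnswer t → Φ (tileset e) t out
    from refl = subst (λ c → Eval c t (tilesetAnswer t)) (sym (decode-tileset e))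
                      (Eval-tilesetCode⇐ (decode e) t _ _ (Φ-χ _) (Φ-χ _))

  tilesetAnswer-tile : ∀ tl → tilesetAnswer (encodeTile tl) ≡ 1 ∸ tileDefect χ tl
  tilesetAnswer-tile tl
    rewrite check-tile tl (χ (run query₁ᴾ (encodeTile tl))) (χ (run query₂ᴾ (encodeTile tl)))
          | run-upSequence tl =
    tileCheck-boolean (left tl) (up tl) (right tl) (bottom tl) _ _ (χ≤1 _)

  member⇔Prototile : ∀ tl → Φ (tileset e) (encodeTile tl) 1 ⇔ Prototile χ tl
  member⇔Prototile tl = mk⇔
    (λ member → Equivalence.to (tileDefect≡0⇔Prototile χ tl)
      (Equivalence.to (1∸n≡1⇔n≡0 _) (trans (sym (tilesetAnswer-tile tl))
        (sym (Equivalence.to (Φ-tileset⇔ (encodeTile tl) 1) member)))))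
    (λ prototile → Equivalence.from (Φ-tileset⇔ (encodeTile tl) 1)
      (sym (trans (tilesetAnswer-tile tl)
        (Equivalence.from (1∸n≡1⇔n≡0 _) (Equivalence.from (tileDefect≡0⇔Prototile χ tl) prototile)))))

  CharFn-tileset : CharFn (tileset e)
  CharFn-tileset t = tilesetAnswer t , Equivalence.from (Φ-tileset⇔ t _) refl ,
    subst (λ a → a ≡ 0 ⊎ a ≡ 1)
      (sym (trans (cong tilesetAnswer (sym (encodeTile-decodeTile t))) (tilesetAnswer-tile (decodeTile t))))
      (1∸n≡0⊎1∸n≡1 (tileDefect χ (decodeTile t)))

  IsTree⇔PrefixClosed : IsTree e ⇔ PrefixClosed χ
  IsTree⇔PrefixClosed = mk⇔
    (λ isTree τ ρ → to ∘ isTree τ ρ ∘ from)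
    (λ closed τ ρ → from ∘ closed τ ρ ∘ to)
    where
    to : ∀ {x} → Φ e x 1 → χ x ≡ 1
    to = Equivalence.to (Φ⇔χ _ 1)
    from : ∀ {x} → χ x ≡ 1 → Φ e x 1
    from = Equivalence.from (Φ⇔χ _ 1)

  path⇔InfinitePath : (Σ (ℕ → ℕ) λ p → ∀ k → InTree e (applyUpTo p k)) ⇔ InfinitePath χ
  path⇔InfinitePath = mk⇔
    (λ (p , in-tree) → p , Equivalence.to (Φ⇔χ _ 1) ∘ in-tree)
    (λ (p , in-tree) → p , Equivalence.from (Φ⇔χ _ 1) ∘ in-tree)

-- A tile whose upper colour stores the reversal of the sequence coded by x
-- makes the tile set consult φ_e at x.
probeTile : ℕ → Tile
probeTile x = ⟨ 0 , colour 0 0 (codeSeq (reverse (decodeSeq x))) , 0 , 0 ⟩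

query₁-probeTile : ∀ x → run query₁ᴾ (encodeTile (probeTile x)) ≡ x
query₁-probeTile x = begin
  reverseCode (run upSequenceᴾ (encodeTile (probeTile x)))       ≡⟨ cong reverseCode (run-upSequence (probeTile x)) ⟩
  reverseCode (slot₂ (colour 0 0 (codeSeq (reverse (decodeSeq x))))) ≡⟨ cong reverseCode (slot₂-colour 0 0 _) ⟩
  reverseCode (codeSeq (reverse (decodeSeq x)))                 ≡⟨ reverseCode-reverse (decodeSeq x) ⟩
  codeSeq (decodeSeq x)                                         ≡⟨ codeSeq-decodeSeq x ⟩
  x                                                             ∎
  where open ≡-Reasoning

CharFn-tileset⇒CharFn : ∀ {e} → CharFn (tileset e) → CharFn e
CharFn-tileset⇒CharFn {e} charFn′ x =
  let (out , Φout , out-boolean) = charFn′ (encodeTile (probeTile x))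
      (v₁ , v₂ , Φv₁ , _ , out≡) =
        Eval-tilesetCode⇒ (decode e) _ out (subst (λ c → Eval c _ out) (decode-tileset e) Φout)
  in v₁ , subst (λ q → Φ e q v₁) (query₁-probeTile x) Φv₁ ,
     ≤1⇒≡0⊎≡1 (tileCheck≤1⇒v₁≤1 0 (up (probeTile x)) 0 0 v₁ v₂
       (subst (_≤ 1) (trans out≡ (check-tile (probeTile x) v₁ v₂)) (≡0⊎≡1⇒≤1 out-boolean)))

WELL⇒ATile : ∀ e → WELL e → ATile (tileset e)
WELL⇒ATile e (charFn , isTree , no-path) =
  CharFn-tileset charFn ,
  (counterTiles , TilingBy-map (λ tl → Equivalence.from (member⇔Prototile charFn tl)) (counterTiling (χ charFn))) ,
  λ T tiling → Prototile-aperiodic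
    (Equivalence.to (IsTree⇔PrefixClosed charFn) isTree)
    (no-path ∘ Equivalence.from (path⇔InfinitePath charFn))
    (TilingBy-map (λ tl → Equivalence.to (member⇔Prototile charFn tl)) tiling)

module _ {e : ℕ} (charFn : CharFn e) where

  no-periodic-tiling : (∀ T → Tiling (tileset e) T → ¬ Periodic T) → ¬ PeriodicallyTileable (χ charFn)
  no-periodic-tiling aperiodic (T , tiling , periodic) =
    aperiodic T (TilingBy-map (λ tl → Equivalence.from (member⇔Prototile charFn tl)) tiling) periodic

  aperiodic⇒WELL : (∀ T → Tiling (tileset e) T → ¬ Periodic T) → WELL e
  aperiodic⇒WELL aperiodic =
    charFn ,
    Equivalence.from (IsTree⇔PrefixClosed charFn) (∷ʳ-closed⇒++-closed _ one-step) ,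
    no-periodic-tiling aperiodic ∘ path⇒PeriodicallyTileable ∘ Equivalence.to (path⇔InfinitePath charFn)
    where
    one-step : ∀ σ a → χ charFn (codeSeq (σ ∷ʳ a)) ≡ 1 → χ charFn (codeSeq σ) ≡ 1
    one-step σ a extension-in = [ absurd-prefix-out , id ]′ (proj₂ (proj₂ (charFn (codeSeq σ))))
      where
      absurd-prefix-out : χ charFn (codeSeq σ) ≡ 0 → χ charFn (codeSeq σ) ≡ 1
      absurd-prefix-out prefix-out =
        ⊥-elim (no-periodic-tiling aperiodic (¬PrefixClosed⇒PeriodicallyTileable extension-in prefix-out))

ATile⇒WELL : ∀ e → ATile (tileset e) → WELL e
ATile⇒WELL e (charFn′ , _ , aperiodic) = aperiodic⇒WELL (CharFn-tileset⇒CharFn charFn′) aperiodic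

mainTheorem18 : WELL ≤m ATile
mainTheorem18 = encode (code tilesetᴾ) , total , reduction
  where
  decoded : ∀ {x y} → Eval (code tilesetᴾ) x y ≡ Φ (encode (code tilesetᴾ)) x y
  decoded {x} {y} = cong (λ c → Eval c x y) (sym (decode-encode (code tilesetᴾ)))
  total : ∀ x → Σ ℕ λ y → Φ (encode (code tilesetᴾ)) x y
  total x = tileset x , subst id decoded (tileset-evaluates x)
  reduction : ∀ x y → Φ (encode (code tilesetᴾ)) x y → WELL x ⇔ ATile y
  reduction x y Φxy = subst (λ y → WELL x ⇔ ATile y)
    (Eval-deterministic (tileset-evaluates x) (subst id (sym decoded) Φxy) refl)
    (mk⇔ (WELL⇒ATile x) (ATile⇒WELL x))
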